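{- Let $n$ and $k$ be positive integers such that $n-k$ is odd and $\frac{n+1}{3}\leq k\leq n-1$. Then there exists a (simple, undirected) graph $G$ with $n$ vertices and connectivity $k$ containing two adjacent vertices $x$ and $y$ with $d_x=d_y=k$ such that $$\kappa_{LLY}(x,y)=\frac{2k-n+2}{k}.$$
   Context: The connectivity of a non-complete graph is the minimum number of vertices whose removal disconnects it; for $K_n$ it is $n-1$. $d(x,y)$ is the graph distance and $d_x$ the degree of $x$. For $p\in[0,1]$ and a vertex $x$, $\mu_x^p$ is the probability measure with $\mu_x^p(x)=p$, $\mu_x^p(y)=\frac{1-p}{d_x}$ if $y$ is adjacent to $x$, and $0$ otherwise. For probability measures $\mu_1,\mu_2$ on $V$, $W(\mu_1,\mu_2)=\inf_\pi\sum_{x,y}d(x,y)\pi(x,y)$ over all $\pi:V\times V\to[0,1]$ with marginals $\mu_1$ and $\mu_2$. For distinct vertices $x,y$, $\kappa_p(x,y)=1-\frac{W(\mu_x^p,\mu_y^p)}{d(x,y)}$ and $\kappa_{LLY}(x,y)=\lim_{p\to1}\frac{\kappa_p(x,y)}{1-p}$.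
   Formalization: The parameter p in the limit defining $\kappa_{LLY}(x,y)$ and the values of the transport plans π in $W(\mu_1,\mu_2)$ are taken in the rationals. -}

module Defs where

open import Data.Bool using (Bool; true; false; _∧_; _∨_; not; if_then_else_)
open import Data.Nat as ℕ using (ℕ; zero; suc)
open import Data.Fin using (Fin; _≟_)
open import Data.List using (List; map; foldr; upTo; allFin)
open import Data.Nat.ListAction using (sum)
open import Data.Bool.ListAction using (any)
open import Data.Integer using (ℤ; +_)
open import Data.Rational as ℚ using (ℚ; 0ℚ; 1ℚ; _+_; _*_; _-_; _≤_; _<_; ∣_∣; _/_)
open import Data.Product using (Σ; ∃; _×_; _,_)
open import Relation.Nullary using (¬_; yes; no)
open import Relation.Nullary.Decidable using (⌊_⌋)
open import Relation.Binary.PropositionalEquality using (_≡_; _≢_)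

record Graph (n : ℕ) : Set where
  field
    adj    : Fin n → Fin n → Bool
    sym    : ∀ x y → adj x y ≡ adj y x
    irrefl : ∀ x → adj x x ≡ false
open Graph public

deg : ∀ {n} → Graph n → Fin n → ℕ
deg {n} G x = sum (map (λ y → if adj G x y then 1 else 0) (allFin n))

reach : ∀ {n} → (Fin n → Fin n → Bool) → ℕ → Fin n → Fin n → Bool
reach A zero    x y = ⌊ x ≟ y ⌋
reach {n} A (suc m) x y = reach A m x y ∨ any (λ z → A x z ∧ reach A m z y) (allFin n)

-- Graph distance d(x,y) = least m with a walk of length m from x to y
-- (= #{m < n | not reachable within m steps}; equals n if unreachable,
--  which never happens in a connected graph).
dist : ∀ {n} → Graph n → Fin n → Fin n → ℕ
dist {n} G x y = sum (map (λ m → if reach (adj G) m x y then 0 else 1) (upTo n))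

Subset : ℕ → Set
Subset n = Fin n → Bool

size : ∀ {n} → Subset n → ℕ
size {n} S = sum (map (λ v → if S v then 1 else 0) (allFin n))

removeAdj : ∀ {n} → Graph n → Subset n → Fin n → Fin n → Bool
removeAdj G S x y = adj G x y ∧ not (S x) ∧ not (S y)

Disconnects : ∀ {n} → Graph n → Subset n → Set
Disconnects {n} G S =
  Σ (Fin n) λ u → Σ (Fin n) λ v →
    (S u ≡ false) × (S v ≡ false) × (reach (removeAdj G S) n u v ≡ false)

Complete : ∀ {n} → Graph n → Set
Complete G = ∀ x y → x ≢ y → adj G x y ≡ true

IsConnectivity : ∀ {n} → Graph n → ℕ → Set
IsConnectivity {n} G k =
  (Complete G → k ≡ ℕ.pred n) ×
  (¬ Complete G →
     (Σ (Subset n) λ S → Disconnects G S × size S ≡ k) ×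
     (∀ S → Disconnects G S → k ℕ.≤ size S))

Σℚ : ∀ {n} → (Fin n → ℚ) → ℚ
Σℚ {n} f = foldr (λ v acc → f v + acc) 0ℚ (allFin n)

-- 1/m for m ≥ 1 (0 for m = 0, never used).
invℕ : ℕ → ℚ
invℕ zero    = 0ℚ
invℕ (suc m) = + 1 / suc m

-- Total reciprocal on ℚ (0 at 0, never used there).
recip : ℚ → ℚ
recip q with q ℚ.≟ 0ℚ
... | yes _ = 0ℚ
... | no q≢0 = ℚ.1/_ q {{ℚ.≢-nonZero q≢0}}

fromℕ : ℕ → ℚ
fromℕ m = + m / 1

μ : ∀ {n} → Graph n → ℚ → Fin n → Fin n → ℚ
μ G p x y with x ≟ y
... | yes _ = p
... | no _  = if adj G x y then (1ℚ - p) * invℕ (deg G x) else 0ℚ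

IsCoupling : ∀ {n} → (Fin n → ℚ) → (Fin n → ℚ) → (Fin n → Fin n → ℚ) → Set
IsCoupling μ₁ μ₂ π =
  (∀ x y → 0ℚ ≤ π x y × π x y ≤ 1ℚ) ×
  (∀ x → Σℚ (λ y → π x y) ≡ μ₁ x) ×
  (∀ y → Σℚ (λ x → π x y) ≡ μ₂ y)

cost : ∀ {n} → Graph n → (Fin n → Fin n → ℚ) → ℚ
cost G π = Σℚ (λ x → Σℚ (λ y → fromℕ (dist G x y) * π x y))

IsW : ∀ {n} → Graph n → (Fin n → ℚ) → (Fin n → ℚ) → ℚ → Set
IsW {n} G μ₁ μ₂ w =
  (∀ π → IsCoupling μ₁ μ₂ π → w ≤ cost G π) ×
  (∀ ε → 0ℚ < ε → Σ (Fin n → Fin n → ℚ) λ π → IsCoupling μ₁ μ₂ π × cost G π < w + ε)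

-- κ_p(x,y) = 1 - W(μ_x^p, μ_y^p)/d(x,y), given w = W(μ_x^p, μ_y^p).
κp : ∀ {n} → Graph n → Fin n → Fin n → ℚ → ℚ
κp G x y w = 1ℚ - w * invℕ (dist G x y)

IsKappaLLY : ∀ {n} → Graph n → Fin n → Fin n → ℚ → Set
IsKappaLLY G x y L =
  ∀ ε → 0ℚ < ε → Σ ℚ λ δ → 0ℚ < δ ×
    (∀ p → 1ℚ - δ < p → p < 1ℚ → 0ℚ ≤ p →
      Σ ℚ λ w → IsW G (μ G p x) (μ G p y) w ×
        ∣ κp G x y w * recip (1ℚ - p) - L ∣ < ε)

-- The graph is a blow-up of a pattern with seven parts: adjacent vertices x and y, c common
-- neighbours C, further neighbours A₁ (m of them) and A₂ (a of them) of x, further neighbours B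
-- (m + a of them) of y, and m relays R between A₁ and B. Every part is a clique, and the hubs
-- C ∪ A₂ ∪ R are adjacent to every vertex other than x and y. Then n = 2 + c + 3m + 2a and
-- k = deg x = deg y = 1 + c + m + a, and k + 1 ≤ n ≤ 3k - 1 suffices to solve for c, m, a.
--
-- Removing N(x) separates x from B. A set S of fewer than k vertices either misses a hub, which
-- every surviving vertex then reaches (x and y because N(x), N(y) and (N(x) ∪ N(y)) ∖ {x, y}
-- have at least k vertices), or it consists of the c + m + a hubs only, and the surviving
-- vertices x, y, A₁, B hang on the edge xy. So the connectivity is k (for m = a = 0 the graph
-- is complete).
--
-- For ½ < p < 1 let q = (1 - p)/k. Sending p - q from x to y, keeping q on x, y and C, and
-- spreading the mass q of each vertex of A₁ ∪ A₂ evenly over B is an optimal transport plan: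
-- the distance to {y} ∪ B is a 1-Lipschitz potential which drops by the full distance along
-- every pair the plan uses. Hence W = p - q + (2m + a)q, so κ_p(x,y) = (1 - p)(2k - n + 2)/k
-- for all these p, and κ_LLY(x,y) = (2k - n + 2)/k.

module Submission where

open import Defs
open import Data.Nat using (ℕ; _+_; _*_; _∸_; _≤_; _%_)
open import Data.Fin using (Fin)
open import Data.Bool using (true)
open import Data.Product using (Σ; _×_)
open import Relation.Binary.PropositionalEquality using (_≡_)
open import Data.Rational using (ℚ; _-_) renaming (_*_ to _*ℚ_)

open import Level using (0ℓ)
open import Function using (_∘_)
open import Algebra.Bundles using (CommutativeRing)
import Algebra.Properties.Semiring.Sum as SemiringSum
open import Data.Nat as ℕ using (zero; suc; z≤n; s≤s; _<_)
import Data.Nat.Properties as ℕP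
import Data.Nat.Coprimality as Coprimality
open import Data.Nat.ListAction using (sum)
open import Data.Nat.Tactic.RingSolver using (solve)
open import Data.Fin as Fin using (zero; suc; _≟_)
import Data.Fin.Properties as FinP
open import Data.Bool as Bool using (Bool; false; _∧_; _∨_; not; if_then_else_)
import Data.Bool.Properties as BoolP
open import Data.Bool.ListAction using (any)
open import Data.List as List using (List; []; _∷_; allFin; tabulate; applyUpTo)
import Data.List.Properties as ListP
open import Data.List.Membership.Propositional using (_∈_)
open import Data.List.Membership.Propositional.Properties using (∈-allFin)
open import Data.List.Relation.Unary.Any using (here; there)
import Data.List.Relation.Unary.All as All
open import Data.Vec as Vec using (Vec; lookup; replicate; _++_)
import Data.Vec.Relation.Unary.All as VecAll
import Data.Vec.Relation.Unary.All.Properties as VecAllP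
import Data.Integer as ℤ
import Data.Integer.Properties as ℤP
open import Data.Rational as Q using (mkℚ; 0ℚ; 1ℚ; ½)
import Data.Rational.Properties as QP
import Data.Rational.Unnormalised as Qᵘ
import Data.Rational.Unnormalised.Properties as QᵘP
open import Data.Product using (_,_; proj₁; proj₂; ∃)
open import Data.Sum as Sum using (_⊎_; inj₁; inj₂)
open import Data.Empty using (⊥-elim)
import Relation.Binary.PropositionalEquality as ≡
open import Relation.Binary.PropositionalEquality
  using (refl; trans; cong; cong₂; subst; subst₂; _≢_; module ≡-Reasoning)
open import Relation.Nullary using (¬_; yes; no)
open import Relation.Nullary.Decidable
  using (⌊_⌋; True; toWitness; toSum; dec-true; dec-false; isYes≗does; dec⇒maybe; _×-dec_; _⊎-dec_; _→-dec_)
open import Relation.Unary using (Decidable)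
import Tactic.RingSolver.Core.AlmostCommutativeRing as ACR
open import Tactic.RingSolver using (solve-∀)

open SemiringSum (CommutativeRing.semiring QP.+-*-commutativeRing)
  using (∑-distrib-+; ∑-comm)
  renaming (sum to ∑; sum-cong-≗ to ∑-cong; *-distribˡ-sum to *-distribˡ-∑; sum-remove to ∑-remove;
            sum-replicate-zero to ∑-zero)
open SemiringSum ℕP.+-*-semiring
  using ()
  renaming (sum to ∑ℕ; sum-cong-≗ to ∑ℕ-cong; sum-remove to ∑ℕ-remove; sum-replicate-zero to ∑ℕ-zero)

ℚ-ring : ACR.AlmostCommutativeRing 0ℓ 0ℓ
ℚ-ring = ACR.fromCommutativeRing QP.+-*-commutativeRing (λ x → dec⇒maybe (0ℚ Q.≟ x))

coprime-to-1 : ∀ a → Coprimality.Coprime a 1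
coprime-to-1 a = Coprimality.sym (Coprimality.1-coprimeTo a)

fromℕ-mkℚ : ∀ a → fromℕ a ≡ mkℚ (ℤ.+ a) 0 (coprime-to-1 a)
fromℕ-mkℚ a = QP.normalize-coprime (coprime-to-1 a)

fromℕ-+ : ∀ a b → fromℕ (a + b) ≡ fromℕ a Q.+ fromℕ b
fromℕ-+ a b rewrite fromℕ-mkℚ a | fromℕ-mkℚ b | fromℕ-mkℚ (a + b) =
  QP.toℚᵘ-injective (QᵘP.≃-trans (Qᵘ.*≡* numerators)
    (QᵘP.≃-sym (QP.toℚᵘ-homo-+ (mkℚ (ℤ.+ a) 0 (coprime-to-1 a)) (mkℚ (ℤ.+ b) 0 (coprime-to-1 b)))))
  where
  numerators : ℤ.+ (a + b) ℤ.* ℤ.+ 1 ≡ (ℤ.+ a ℤ.* ℤ.+ 1 ℤ.+ ℤ.+ b ℤ.* ℤ.+ 1) ℤ.* ℤ.+ 1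
  numerators rewrite ℤP.*-identityʳ (ℤ.+ a) | ℤP.*-identityʳ (ℤ.+ b) = refl

fromℕ-mono-≤ : ∀ {a b} → a ≤ b → fromℕ a Q.≤ fromℕ b
fromℕ-mono-≤ {a} {b} a≤b rewrite fromℕ-mkℚ a | fromℕ-mkℚ b =
  Q.*≤* (subst₂ ℤ._≤_ (≡.sym (ℤP.*-identityʳ (ℤ.+ a))) (≡.sym (ℤP.*-identityʳ (ℤ.+ b))) (ℤ.+≤+ a≤b))

fromℕ*invℕ : ∀ {j} → 1 ≤ j → fromℕ j Q.* invℕ j ≡ 1ℚ
fromℕ*invℕ {suc j} _ rewrite fromℕ-mkℚ (suc j) | QP.normalize-coprime {1} {j} (Coprimality.1-coprimeTo (suc j)) =
  QP.*-inverseʳ (mkℚ (ℤ.+ suc j) 0 (coprime-to-1 (suc j)))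

invℕ-nonNeg : ∀ j → 0ℚ Q.≤ invℕ j
invℕ-nonNeg zero = QP.≤-refl
invℕ-nonNeg (suc j) rewrite QP.normalize-coprime {1} {j} (Coprimality.1-coprimeTo (suc j)) = Q.*≤* (ℤ.+≤+ z≤n)

invℕ≤1 : ∀ j → invℕ j Q.≤ 1ℚ
invℕ≤1 zero = Q.*≤* (ℤ.+≤+ z≤n)
invℕ≤1 (suc j) rewrite QP.normalize-coprime {1} {j} (Coprimality.1-coprimeTo (suc j)) = Q.*≤* (ℤ.+≤+ (s≤s z≤n))

≤-+⇒-≤ : ∀ {a b c} → a Q.≤ b Q.+ c → a - b Q.≤ c
≤-+⇒-≤ {a} {b} {c} a≤b+c = subst (a - b Q.≤_) (cancel b c) (QP.+-monoˡ-≤ (Q.- b) a≤b+c)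
  where
  cancel : ∀ b c → b Q.+ c - b ≡ c
  cancel = solve-∀ ℚ-ring

+-≤⇒≤- : ∀ {a b c} → c Q.+ b Q.≤ a → c Q.≤ a - b
+-≤⇒≤- {a} {b} {c} c+b≤a = subst (Q._≤ a - b) (cancel b c) (QP.+-monoˡ-≤ (Q.- b) c+b≤a)
  where
  cancel : ∀ b c → c Q.+ b - b ≡ c
  cancel = solve-∀ ℚ-ring

<-+-pos : ∀ {w ε} → 0ℚ Q.< ε → w Q.< w Q.+ ε
<-+-pos {w} {ε} ε>0 = subst (Q._< w Q.+ ε) (QP.+-identityʳ w) (QP.+-monoʳ-< w ε>0)

*-monoʳ-≤-nonNeg′ : ∀ {a b} c → 0ℚ Q.≤ c → a Q.≤ b → a Q.* c Q.≤ b Q.* c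
*-monoʳ-≤-nonNeg′ c c≥0 = QP.*-monoʳ-≤-nonNeg c {{Q.nonNegative c≥0}}

0<-⇐< : ∀ {a b} → a Q.< b → 0ℚ Q.< b - a
0<-⇐< {a} {b} a<b = subst (Q._< b - a) (QP.+-inverseʳ a) (QP.+-monoˡ-< (Q.- a) a<b)

0≤* : ∀ {a b} → 0ℚ Q.≤ a → 0ℚ Q.≤ b → 0ℚ Q.≤ a Q.* b
0≤* {a} {b} 0≤a 0≤b = subst (Q._≤ a Q.* b) (QP.*-zeroˡ b) (*-monoʳ-≤-nonNeg′ b 0≤b 0≤a)

recip-inverseʳ : ∀ r → r ≢ 0ℚ → r Q.* recip r ≡ 1ℚ
recip-inverseʳ r r≢0 with r Q.≟ 0ℚ
... | yes r≡0  = ⊥-elim (r≢0 r≡0)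
... | no  r≢0′ = QP.*-inverseʳ r {{Q.≢-nonZero r≢0′}}

ind : Bool → ℕ
ind b = if b then 1 else 0

𝟙 : Bool → ℚ
𝟙 b = if b then 1ℚ else 0ℚ

fromℕ-ind : ∀ b → fromℕ (ind b) ≡ 𝟙 b
fromℕ-ind false = refl
fromℕ-ind true  = refl

fromℕ-if : ∀ b a → fromℕ (if b then a else 0) ≡ fromℕ a Q.* 𝟙 b
fromℕ-if true  a = ≡.sym (QP.*-identityʳ (fromℕ a))
fromℕ-if false a = ≡.sym (QP.*-zeroʳ (fromℕ a))

*𝟙-bounds : ∀ α b → 0ℚ Q.≤ α → 0ℚ Q.≤ α Q.* 𝟙 b × α Q.* 𝟙 b Q.≤ α
*𝟙-bounds α true  0≤α = subst (0ℚ Q.≤_) (≡.sym (QP.*-identityʳ α)) 0≤α , QP.≤-reflexive (QP.*-identityʳ α)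
*𝟙-bounds α false 0≤α = QP.≤-reflexive (≡.sym (QP.*-zeroʳ α)) , subst (Q._≤ α) (≡.sym (QP.*-zeroʳ α)) 0≤α

balance-identity : ∀ p q s i a l → s Q.+ a ≡ i Q.+ l →
  q Q.* s Q.+ (p - q) Q.* (i Q.* 1ℚ) Q.+ q Q.* a ≡ p Q.* i Q.+ q Q.* l
balance-identity p q s i a l s+a≡i+l = begin
  q Q.* s Q.+ (p - q) Q.* (i Q.* 1ℚ) Q.+ q Q.* a    ≡⟨ collect p q s i a ⟩
  q Q.* (s Q.+ a) Q.+ (p - q) Q.* i                 ≡⟨ cong (λ z → q Q.* z Q.+ (p - q) Q.* i) s+a≡i+l ⟩
  q Q.* (i Q.+ l) Q.+ (p - q) Q.* i                 ≡⟨ expand p q i l ⟩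
  p Q.* i Q.+ q Q.* l                               ∎
  where
  open ≡-Reasoning
  collect : ∀ p q s i a → q Q.* s Q.+ (p - q) Q.* (i Q.* 1ℚ) Q.+ q Q.* a ≡ q Q.* (s Q.+ a) Q.+ (p - q) Q.* i
  collect = solve-∀ ℚ-ring
  expand : ∀ p q i l → q Q.* (i Q.+ l) Q.+ (p - q) Q.* i ≡ p Q.* i Q.+ q Q.* l
  expand = solve-∀ ℚ-ring

curvature-identity : ∀ p r A N K X Y → A Q.+ X ≡ N Q.+ K Q.+ Y → K Q.* r ≡ 1ℚ →
  1ℚ - ((p Q.* 1ℚ Q.+ (1ℚ - p) Q.* r Q.* X) - (p Q.* 0ℚ Q.+ (1ℚ - p) Q.* r Q.* Y)) Q.* 1ℚ ≡
  (1ℚ - p) Q.* ((A - N) Q.* r)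
curvature-identity p r A N K X Y A+X≡N+K+Y K*r≡1 = begin
  1ℚ - ((p Q.* 1ℚ Q.+ (1ℚ - p) Q.* r Q.* X) - (p Q.* 0ℚ Q.+ (1ℚ - p) Q.* r Q.* Y)) Q.* 1ℚ
    ≡⟨ simplify p r X Y ⟩
  (1ℚ - p) Q.* 1ℚ Q.+ (1ℚ - p) Q.* r Q.* (Y - X)
    ≡⟨ cong (λ z → (1ℚ - p) Q.* z Q.+ (1ℚ - p) Q.* r Q.* (Y - X)) K*r≡1 ⟨
  (1ℚ - p) Q.* (K Q.* r) Q.+ (1ℚ - p) Q.* r Q.* (Y - X)
    ≡⟨ rearrange p r N K X Y ⟩
  (1ℚ - p) Q.* ((N Q.+ K Q.+ Y - X - N) Q.* r)
    ≡⟨ cong (λ z → (1ℚ - p) Q.* ((z - X - N) Q.* r)) A+X≡N+K+Y ⟨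
  (1ℚ - p) Q.* ((A Q.+ X - X - N) Q.* r)
    ≡⟨ cancel p r A N X ⟩
  (1ℚ - p) Q.* ((A - N) Q.* r) ∎
  where
  open ≡-Reasoning
  simplify : ∀ p r X Y →
    1ℚ - ((p Q.* 1ℚ Q.+ (1ℚ - p) Q.* r Q.* X) - (p Q.* 0ℚ Q.+ (1ℚ - p) Q.* r Q.* Y)) Q.* 1ℚ ≡
    (1ℚ - p) Q.* 1ℚ Q.+ (1ℚ - p) Q.* r Q.* (Y - X)
  simplify = solve-∀ ℚ-ring
  rearrange : ∀ p r N K X Y → (1ℚ - p) Q.* (K Q.* r) Q.+ (1ℚ - p) Q.* r Q.* (Y - X) ≡
                               (1ℚ - p) Q.* ((N Q.+ K Q.+ Y - X - N) Q.* r)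
  rearrange = solve-∀ ℚ-ring
  cancel : ∀ p r A N X → (1ℚ - p) Q.* ((A Q.+ X - X - N) Q.* r) ≡ (1ℚ - p) Q.* ((A - N) Q.* r)
  cancel = solve-∀ ℚ-ring

⌊≟⌋-refl : ∀ {n} (u : Fin n) → ⌊ u ≟ u ⌋ ≡ true
⌊≟⌋-refl u = trans (isYes≗does (u ≟ u)) (dec-true (u ≟ u) refl)

⌊≟⌋-≢ : ∀ {n} {u v : Fin n} → u ≢ v → ⌊ u ≟ v ⌋ ≡ false
⌊≟⌋-≢ {u = u} {v} u≢v = trans (isYes≗does (u ≟ v)) (dec-false (u ≟ v) u≢v)

⌊≟⌋-sym : ∀ {n} (u v : Fin n) → ⌊ u ≟ v ⌋ ≡ ⌊ v ≟ u ⌋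
⌊≟⌋-sym u v with u ≟ v
... | yes refl = ≡.sym (⌊≟⌋-refl u)
... | no  u≢v  = ≡.sym (⌊≟⌋-≢ (u≢v ∘ ≡.sym))

Σℚ-tabulate : ∀ {m} n (g : Fin n → Fin m) (f : Fin m → ℚ) →
  List.foldr (λ v acc → f v Q.+ acc) 0ℚ (tabulate g) ≡ ∑ (f ∘ g)
Σℚ-tabulate zero    g f = refl
Σℚ-tabulate (suc n) g f = cong (f (g zero) Q.+_) (Σℚ-tabulate n (g ∘ suc) f)

Σℚ≡∑ : ∀ {n} (f : Fin n → ℚ) → Σℚ f ≡ ∑ f
Σℚ≡∑ {n} f = Σℚ-tabulate n (λ i → i) f

sum-tabulate : ∀ {m} n (g : Fin n → Fin m) (h : Fin m → ℕ) →
  sum (List.map h (tabulate g)) ≡ ∑ℕ (h ∘ g)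
sum-tabulate zero    g h = refl
sum-tabulate (suc n) g h = cong (h (g zero) +_) (sum-tabulate n (g ∘ suc) h)

sum-allFin≡∑ℕ : ∀ {n} (h : Fin n → ℕ) → sum (List.map h (allFin n)) ≡ ∑ℕ h
sum-allFin≡∑ℕ {n} h = sum-tabulate n (λ i → i) h

size≡∑ℕ : ∀ {n} (S : Subset n) → size S ≡ ∑ℕ (ind ∘ S)
size≡∑ℕ S = sum-allFin≡∑ℕ (ind ∘ S)

fromℕ-∑ℕ : ∀ {n} (h : Fin n → ℕ) → fromℕ (∑ℕ h) ≡ ∑ (fromℕ ∘ h)
fromℕ-∑ℕ {zero}  h = refl
fromℕ-∑ℕ {suc n} h =
  trans (fromℕ-+ (h zero) (∑ℕ (h ∘ suc))) (cong (fromℕ (h zero) Q.+_) (fromℕ-∑ℕ (h ∘ suc)))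

∑-mono-≤ : ∀ {n} {f g : Fin n → ℚ} → (∀ i → f i Q.≤ g i) → ∑ f Q.≤ ∑ g
∑-mono-≤ {zero}  f≤g = QP.≤-refl
∑-mono-≤ {suc n} f≤g = QP.+-mono-≤ (f≤g zero) (∑-mono-≤ (f≤g ∘ suc))

∑ℕ-mono-≤ : ∀ {n} {f g : Fin n → ℕ} → (∀ i → f i ≤ g i) → ∑ℕ f ≤ ∑ℕ g
∑ℕ-mono-≤ {zero}  f≤g = z≤n
∑ℕ-mono-≤ {suc n} f≤g = ℕP.+-mono-≤ (f≤g zero) (∑ℕ-mono-≤ (f≤g ∘ suc))

∑ℕ-mono-< : ∀ {n} {f g : Fin n → ℕ} (i : Fin n) → (∀ j → f j ≤ g j) → f i < g i → ∑ℕ f < ∑ℕ g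
∑ℕ-mono-< {suc n} {f} {g} i f≤g fi<gi =
  subst₂ _<_ (≡.sym (∑ℕ-remove {i = i} f)) (≡.sym (∑ℕ-remove {i = i} g))
    (ℕP.+-mono-<-≤ fi<gi (∑ℕ-mono-≤ (f≤g ∘ Fin.punchIn i)))

∑-δ : ∀ {n} {f : Fin n → ℚ} (i : Fin n) → (∀ j → j ≢ i → f j ≡ 0ℚ) → ∑ f ≡ f i
∑-δ {suc n} {f} i off-i = begin
  ∑ f                                  ≡⟨ ∑-remove {i = i} f ⟩
  f i Q.+ ∑ (f ∘ Fin.punchIn i)        ≡⟨ cong (f i Q.+_) (∑-cong (λ j → off-i _ (FinP.punchInᵢ≢i i j))) ⟩
  f i Q.+ ∑ {n} (λ _ → 0ℚ)             ≡⟨ cong (f i Q.+_) (∑-zero n) ⟩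
  f i Q.+ 0ℚ                           ≡⟨ QP.+-identityʳ (f i) ⟩
  f i                                  ∎
  where open ≡-Reasoning

∑-𝟙 : ∀ {n} (T : Subset n) → ∑ (𝟙 ∘ T) ≡ fromℕ (size T)
∑-𝟙 T = begin
  ∑ (𝟙 ∘ T)                 ≡⟨ ∑-cong (λ v → fromℕ-ind (T v)) ⟨
  ∑ (fromℕ ∘ ind ∘ T)       ≡⟨ fromℕ-∑ℕ (ind ∘ T) ⟨
  fromℕ (∑ℕ (ind ∘ T))      ≡⟨ cong fromℕ (size≡∑ℕ T) ⟨
  fromℕ (size T)            ∎
  where open ≡-Reasoning

∑-indicators : ∀ {n} (α β γ : ℚ) (f g h : Fin n → Bool) {s t r} →
  ∑ (𝟙 ∘ f) ≡ s → ∑ (𝟙 ∘ g) ≡ t → ∑ (𝟙 ∘ h) ≡ r →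
  ∑ (λ v → α Q.* 𝟙 (f v) Q.+ β Q.* 𝟙 (g v) Q.+ γ Q.* 𝟙 (h v)) ≡ α Q.* s Q.+ β Q.* t Q.+ γ Q.* r
∑-indicators α β γ f g h {s} {t} {r} ∑f ∑g ∑h = begin
  ∑ (λ v → α Q.* 𝟙 (f v) Q.+ β Q.* 𝟙 (g v) Q.+ γ Q.* 𝟙 (h v))
    ≡⟨ ∑-distrib-+ (λ v → α Q.* 𝟙 (f v) Q.+ β Q.* 𝟙 (g v)) (λ v → γ Q.* 𝟙 (h v)) ⟩
  ∑ (λ v → α Q.* 𝟙 (f v) Q.+ β Q.* 𝟙 (g v)) Q.+ ∑ (λ v → γ Q.* 𝟙 (h v))
    ≡⟨ cong (Q._+ ∑ (λ v → γ Q.* 𝟙 (h v))) (∑-distrib-+ (λ v → α Q.* 𝟙 (f v)) (λ v → β Q.* 𝟙 (g v))) ⟩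
  ∑ (λ v → α Q.* 𝟙 (f v)) Q.+ ∑ (λ v → β Q.* 𝟙 (g v)) Q.+ ∑ (λ v → γ Q.* 𝟙 (h v))
    ≡⟨ cong₂ Q._+_ (cong₂ Q._+_ (*-distribˡ-∑ α (𝟙 ∘ f)) (*-distribˡ-∑ β (𝟙 ∘ g)))
                   (*-distribˡ-∑ γ (𝟙 ∘ h)) ⟨
  α Q.* ∑ (𝟙 ∘ f) Q.+ β Q.* ∑ (𝟙 ∘ g) Q.+ γ Q.* ∑ (𝟙 ∘ h)
    ≡⟨ cong₂ Q._+_ (cong₂ Q._+_ (cong (α Q.*_) ∑f) (cong (β Q.*_) ∑g)) (cong (γ Q.*_) ∑h) ⟩
  α Q.* s Q.+ β Q.* t Q.+ γ Q.* r ∎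
  where open ≡-Reasoning

∑-𝟙-∧ˡ : ∀ {n} b (T : Subset n) → ∑ (λ v → 𝟙 (b ∧ T v)) ≡ 𝟙 b Q.* fromℕ (size T)
∑-𝟙-∧ˡ true  T = trans (∑-𝟙 T) (≡.sym (QP.*-identityˡ (fromℕ (size T))))
∑-𝟙-∧ˡ {n} false T = trans (∑-zero n) (≡.sym (QP.*-zeroˡ (fromℕ (size T))))

∑-𝟙-∧ʳ : ∀ {n} b (T : Subset n) → ∑ (λ u → 𝟙 (T u ∧ b)) ≡ 𝟙 b Q.* fromℕ (size T)
∑-𝟙-∧ʳ b T = trans (∑-cong (λ u → cong 𝟙 (BoolP.∧-comm (T u) b))) (∑-𝟙-∧ˡ b T)

∑-𝟙-diagonalʳ : ∀ {n} (b : Fin n → Bool) u → ∑ (λ v → 𝟙 (⌊ u ≟ v ⌋ ∧ b u)) ≡ 𝟙 (b u)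
∑-𝟙-diagonalʳ b u = trans (∑-δ u (λ v v≢u → cong (λ e → 𝟙 (e ∧ b u)) (⌊≟⌋-≢ (v≢u ∘ ≡.sym))))
                          (cong (λ e → 𝟙 (e ∧ b u)) (⌊≟⌋-refl u))

∑-𝟙-diagonalˡ : ∀ {n} (b : Fin n → Bool) v → ∑ (λ u → 𝟙 (⌊ u ≟ v ⌋ ∧ b u)) ≡ 𝟙 (b v)
∑-𝟙-diagonalˡ b v = trans (∑-δ v (λ u u≢v → cong (λ e → 𝟙 (e ∧ b u)) (⌊≟⌋-≢ u≢v)))
                          (cong (λ e → 𝟙 (e ∧ b v)) (⌊≟⌋-refl v))

∑ℕ-lookup-++ : ∀ {A : Set} (g : A → ℕ) {k l} (xs : Vec A k) (ys : Vec A l) →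
  ∑ℕ (g ∘ lookup (xs ++ ys)) ≡ ∑ℕ (g ∘ lookup xs) + ∑ℕ (g ∘ lookup ys)
∑ℕ-lookup-++ g Vec.[]       ys = refl
∑ℕ-lookup-++ g (x Vec.∷ xs) ys =
  trans (cong (g x +_) (∑ℕ-lookup-++ g xs ys)) (≡.sym (ℕP.+-assoc (g x) _ _))

∑ℕ-lookup-replicate : ∀ {A : Set} (g : A → ℕ) k x → ∑ℕ (g ∘ lookup (replicate k x)) ≡ k * g x
∑ℕ-lookup-replicate g zero    x = refl
∑ℕ-lookup-replicate g (suc k) x = cong (g x +_) (∑ℕ-lookup-replicate g k x)

∑ℕ-lookup-replicate-++ : ∀ {A : Set} (g : A → ℕ) k x {l} (ys : Vec A l) →
  ∑ℕ (g ∘ lookup (replicate k x ++ ys)) ≡ k * g x + ∑ℕ (g ∘ lookup ys)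
∑ℕ-lookup-replicate-++ g k x ys =
  trans (∑ℕ-lookup-++ g (replicate k x) ys) (cong (_+ ∑ℕ (g ∘ lookup ys)) (∑ℕ-lookup-replicate g k x))

_⊆_ : ∀ {n} → Subset n → Subset n → Set
T ⊆ S = ∀ v → T v ≡ true → S v ≡ true

ind-mono : ∀ {a b} → (a ≡ true → b ≡ true) → ind a ≤ ind b
ind-mono {false}         _ = z≤n
ind-mono {true}  {true}  _ = ℕP.≤-refl
ind-mono {true}  {false} a⇒b with a⇒b refl
... | ()

size-mono-≤ : ∀ {n} {T S : Subset n} → T ⊆ S → size T ≤ size S
size-mono-≤ {T = T} {S} T⊆S =
  subst₂ _≤_ (≡.sym (size≡∑ℕ T)) (≡.sym (size≡∑ℕ S)) (∑ℕ-mono-≤ (λ v → ind-mono (T⊆S v)))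

size-mono-< : ∀ {n} {T S : Subset n} (w : Fin n) → T ⊆ S → T w ≡ false → S w ≡ true → size T < size S
size-mono-< {T = T} {S} w T⊆S Tw Sw = subst₂ _<_ (≡.sym (size≡∑ℕ T)) (≡.sym (size≡∑ℕ S))
  (∑ℕ-mono-< w (λ v → ind-mono (T⊆S v)) (subst₂ (λ a b → ind a < ind b) (≡.sym Tw) (≡.sym Sw) ℕP.≤-refl))

size<⇒∃∉ : ∀ {n} {S T : Subset n} → size S < size T → ∃ λ w → T w ≡ true × S w ≡ false
size<⇒∃∉ {S = S} {T} S<T with FinP.any? (λ w → (T w Bool.≟ true) ×-dec (S w Bool.≟ false))
... | yes w∈T∖S = w∈T∖S
... | no ∄ = ⊥-elim (ℕP.<⇒≱ S<T (size-mono-≤ T⊆S))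
  where
  T⊆S : T ⊆ S
  T⊆S v Tv with S v in Sv
  ... | true  = refl
  ... | false = ⊥-elim (∄ (v , Tv , Sv))

size≤⇒⊇ : ∀ {n} {T S : Subset n} → T ⊆ S → size S ≤ size T → S ⊆ T
size≤⇒⊇ {T = T} T⊆S S≤T v Sv with T v in Tv
... | true  = refl
... | false = ⊥-elim (ℕP.<⇒≱ (size-mono-< v T⊆S Tv Sv) S≤T)

size-∅ : ∀ {n} → size {n} (λ _ → false) ≡ 0
size-∅ {n} = trans (size≡∑ℕ {n} (λ _ → false)) (∑ℕ-zero n)

size-cong : ∀ {n} {S T : Subset n} → (∀ v → S v ≡ T v) → size S ≡ size T
size-cong {S = S} {T} S≗T = trans (size≡∑ℕ S) (trans (∑ℕ-cong (cong ind ∘ S≗T)) (≡.sym (size≡∑ℕ T)))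

1≤size : ∀ {n} {T : Subset n} w → T w ≡ true → 1 ≤ size T
1≤size {n} {T} w Tw = subst (_< size T) (size-∅ {n}) (size-mono-< {T = λ _ → false} w (λ _ ()) refl Tw)

1≤size⇒∃ : ∀ {n} {T : Subset n} → 1 ≤ size T → ∃ λ w → T w ≡ true
1≤size⇒∃ {n} {T} 1≤T =
  let (w , Tw , _) = size<⇒∃∉ {S = λ _ → false} {T} (subst (_< size T) (≡.sym (size-∅ {n})) 1≤T) in w , Tw

-- Walks and distances

any-true : ∀ {A : Set} (p : A → Bool) {xs w} → w ∈ xs → p w ≡ true → any p xs ≡ true
any-true p {x ∷ xs} (here refl) pw rewrite pw = refl
any-true p {x ∷ xs} (there w∈) pw rewrite any-true p w∈ pw = BoolP.∨-zeroʳ (p x)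

any-false : ∀ {A : Set} (p : A → Bool) xs → (∀ z → p z ≡ false) → any p xs ≡ false
any-false p []       _ = refl
any-false p (x ∷ xs) never rewrite never x = any-false p xs never

data Walk {n} (A : Fin n → Fin n → Bool) : ℕ → Fin n → Fin n → Set where
  stay : ∀ {l u} → Walk A l u u
  step : ∀ {l u w v} → A u w ≡ true → Walk A l w v → Walk A (suc l) u v

module _ {n} {A : Fin n → Fin n → Bool} where

  edge : ∀ {u v} → A u v ≡ true → Walk A 1 u v
  edge uv = step uv stay

  weaken : ∀ {l l′ u v} → l ≤ l′ → Walk A l u v → Walk A l′ u v
  weaken _           stay          = stay
  weaken (s≤s l≤l′) (step uw wv) = step uw (weaken l≤l′ wv)

  infixr 5 _◅◅_
  _◅◅_ : ∀ {l₁ l₂ u w v} → Walk A l₁ u w → Walk A l₂ w v → Walk A (l₁ + l₂) u v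
  _◅◅_ {l₁} stay         wv = weaken (ℕP.m≤n+m _ l₁) wv
  step uw′ w′w ◅◅ wv = step uw′ (w′w ◅◅ wv)

  snoc : ∀ {l u w v} → Walk A l u w → A w v ≡ true → Walk A (suc l) u v
  snoc stay         wv = step wv stay
  snoc (step uz zw) wv = step uz (snoc zw wv)

  reverse : (∀ a b → A a b ≡ A b a) → ∀ {l u v} → Walk A l u v → Walk A l v u
  reverse A-sym stay                 = stay
  reverse A-sym (step {u = u} uw wv) = snoc (reverse A-sym wv) (trans (A-sym _ u) uw)

  reach-refl : ∀ l u → reach A l u u ≡ true
  reach-refl zero    u = ⌊≟⌋-refl u
  reach-refl (suc l) u rewrite reach-refl l u = refl

  walk⇒reach : ∀ {l u v} → Walk A l u v → reach A l u v ≡ true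
  walk⇒reach {l} {u} stay = reach-refl l u
  walk⇒reach (step {l} {u} {w} {v} uw wv) =
    trans (cong (reach A l u v ∨_) (any-true (λ z → A u z ∧ reach A l z v) (∈-allFin w)
                                     (cong₂ _∧_ uw (walk⇒reach wv))))
          (BoolP.∨-zeroʳ (reach A l u v))

  isolated⇒unreachable : ∀ {u v} → (∀ z → A u z ≡ false) → u ≢ v → ∀ l → reach A l u v ≡ false
  isolated⇒unreachable isolated u≢v zero    = ⌊≟⌋-≢ u≢v
  isolated⇒unreachable {u} {v} isolated u≢v (suc l) rewrite isolated⇒unreachable isolated u≢v l =
    any-false _ (allFin n) (λ z → cong (_∧ reach A l z v) (isolated z))

stay-or-step : ∀ {n} {A : Fin n → Fin n → Bool} {u v} → u ≡ v ⊎ A u v ≡ true → Walk A 1 u v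
stay-or-step (inj₁ refl) = stay
stay-or-step (inj₂ uv)   = edge uv

sum-applyUpTo-≤ : ∀ (g : ℕ → ℕ) N l → (∀ i → g i ≤ 1) → (∀ i → l ≤ i → g i ≡ 0) →
  sum (applyUpTo g N) ≤ l
sum-applyUpTo-≤ g zero    l       _   _   = z≤n
sum-applyUpTo-≤ g (suc N) zero    g≤1 g≡0 rewrite g≡0 0 z≤n =
  sum-applyUpTo-≤ (g ∘ suc) N zero (g≤1 ∘ suc) (λ i _ → g≡0 (suc i) z≤n)
sum-applyUpTo-≤ g (suc N) (suc l) g≤1 g≡0 =
  ℕP.+-mono-≤ (g≤1 0) (sum-applyUpTo-≤ (g ∘ suc) N l (g≤1 ∘ suc) (λ i l≤i → g≡0 (suc i) (s≤s l≤i)))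

module _ {n} (G : Graph n) where

  unreached : Fin n → Fin n → ℕ → ℕ
  unreached u v m = if reach (adj G) m u v then 0 else 1

  dist≤ : ∀ {l u v} → Walk (adj G) l u v → dist G u v ≤ l
  dist≤ {l} {u} {v} walk =
    subst (_≤ l) (cong sum (≡.sym (ListP.map-upTo (unreached u v) n)))
      (sum-applyUpTo-≤ (unreached u v) n l at-most-1 (λ m l≤m → reached m (walk⇒reach (weaken l≤m walk))))
    where
    at-most-1 : ∀ m → unreached u v m ≤ 1
    at-most-1 m with reach (adj G) m u v
    ... | true  = z≤n
    ... | false = s≤s z≤n
    reached : ∀ m → reach (adj G) m u v ≡ true → unreached u v m ≡ 0
    reached m r rewrite r = refl

  dist-refl : ∀ u → dist G u u ≡ 0
  dist-refl u = ℕP.n≤0⇒n≡0 (dist≤ {0} stay)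

  adjacent⇒dist≤1 : ∀ {u v} → adj G u v ≡ true → dist G u v ≤ 1
  adjacent⇒dist≤1 uv = dist≤ (edge uv)

  reach₁-nonadjacent : ∀ {u v} → u ≢ v → adj G u v ≡ false → reach (adj G) 1 u v ≡ false
  reach₁-nonadjacent {u} {v} u≢v ¬uv rewrite ⌊≟⌋-≢ u≢v = any-false _ (allFin n) not-via
    where
    not-via : ∀ z → (adj G u z ∧ ⌊ z ≟ v ⌋) ≡ false
    not-via z with z ≟ v
    ... | yes refl = trans (BoolP.∧-identityʳ (adj G u z)) ¬uv
    ... | no  _    = BoolP.∧-zeroʳ (adj G u z)

  unreached≡1 : ∀ {m} {u v} → reach (adj G) m u v ≡ false → unreached u v m ≡ 1
  unreached≡1 r rewrite r = refl

1≤dist : ∀ {n} (G : Graph n) {u v} → u ≢ v → 1 ≤ dist G u v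
1≤dist {suc n} G {u} {v} u≢v =
  ℕP.≤-trans (ℕP.≤-reflexive (≡.sym (unreached≡1 G {0} {u} {v} (⌊≟⌋-≢ u≢v)))) (ℕP.m≤m+n _ _)

2≤dist : ∀ {n} (G : Graph n) {u v} → u ≢ v → adj G u v ≡ false → 2 ≤ dist G u v
2≤dist {suc zero}    G {zero} {zero} u≢v _   = ⊥-elim (u≢v refl)
2≤dist {suc (suc n)} G {u} {v} u≢v ¬uv =
  ℕP.+-mono-≤ (ℕP.≤-reflexive (≡.sym (unreached≡1 G {0} {u} {v} (⌊≟⌋-≢ u≢v))))
    (ℕP.≤-trans (ℕP.≤-reflexive (≡.sym (unreached≡1 G {1} {u} {v} (reach₁-nonadjacent G u≢v ¬uv)))) (ℕP.m≤m+n _ _))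

-- Transport and curvature

IsLipschitz : ∀ {n} → Graph n → (Fin n → ℕ) → Set
IsLipschitz G f = ∀ u v → f u ≤ dist G u v + f v

lipschitz-of-steps : ∀ {n} (G : Graph n) (f : Fin n → ℕ) →
  (∀ u v → f u ≤ 2 + f v) → (∀ u v → adj G u v ≡ true → f u ≤ 1 + f v) → IsLipschitz G f
lipschitz-of-steps G f far near u v with u ≟ v
... | yes refl = ℕP.≤-reflexive (cong (_+ f u) (≡.sym (dist-refl G u)))
... | no  u≢v with adj G u v in uv
...   | true  = ℕP.≤-trans (near u v uv) (ℕP.+-monoˡ-≤ (f v) (1≤dist G u≢v))
...   | false = ℕP.≤-trans (far u v) (ℕP.+-monoˡ-≤ (f v) (2≤dist G u≢v uv))

expectation : ∀ {n} → (Fin n → ℕ) → (Fin n → ℚ) → ℚ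
expectation f μ = ∑ (λ u → fromℕ (f u) Q.* μ u)

TightFor : ∀ {n} → Graph n → (Fin n → ℕ) → (Fin n → Fin n → ℚ) → Set
TightFor G f π = ∀ u v → π u v ≡ 0ℚ ⊎ dist G u v + f v ≤ f u

cost≡∑∑ : ∀ {n} (G : Graph n) π → cost G π ≡ ∑ (λ u → ∑ (λ v → fromℕ (dist G u v) Q.* π u v))
cost≡∑∑ G π = trans (Σℚ≡∑ (λ u → Σℚ (λ v → fromℕ (dist G u v) Q.* π u v)))
  (∑-cong (λ u → Σℚ≡∑ (λ v → fromℕ (dist G u v) Q.* π u v)))

module _ {n} {μ₁ μ₂ : Fin n → ℚ} {π : Fin n → Fin n → ℚ} (coupling : IsCoupling μ₁ μ₂ π) where

  private
    row : ∀ u → ∑ (π u) ≡ μ₁ u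
    row u = trans (≡.sym (Σℚ≡∑ (π u))) (proj₁ (proj₂ coupling) u)
    column : ∀ v → ∑ (λ u → π u v) ≡ μ₂ v
    column v = trans (≡.sym (Σℚ≡∑ (λ u → π u v))) (proj₂ (proj₂ coupling) v)

  ∑∑-source : ∀ (g : Fin n → ℚ) → ∑ (λ u → ∑ (λ v → g u Q.* π u v)) ≡ ∑ (λ u → g u Q.* μ₁ u)
  ∑∑-source g = ∑-cong (λ u → trans (≡.sym (*-distribˡ-∑ (g u) (π u))) (cong (g u Q.*_) (row u)))

  ∑∑-target : ∀ (g : Fin n → ℚ) → ∑ (λ u → ∑ (λ v → g v Q.* π u v)) ≡ ∑ (λ v → g v Q.* μ₂ v)
  ∑∑-target g = trans (∑-comm (λ u v → g v Q.* π u v))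
    (∑-cong (λ v → trans (≡.sym (*-distribˡ-∑ (g v) (λ u → π u v))) (cong (g v Q.*_) (column v))))

  module _ {G : Graph n} {f : Fin n → ℕ} where

    private
      F : Fin n → ℚ
      F = fromℕ ∘ f
      D : Fin n → Fin n → ℚ
      D u v = fromℕ (dist G u v)

      split : ∀ a b c → (a Q.+ b) Q.* c ≡ b Q.* c Q.+ a Q.* c
      split = solve-∀ ℚ-ring

      ∑∑-split : ∑ (λ u → ∑ (λ v → F v Q.* π u v Q.+ D u v Q.* π u v))
                 ≡ expectation f μ₂ Q.+ cost G π
      ∑∑-split = begin
        ∑ (λ u → ∑ (λ v → F v Q.* π u v Q.+ D u v Q.* π u v))
          ≡⟨ ∑-cong (λ u → ∑-distrib-+ (λ v → F v Q.* π u v) (λ v → D u v Q.* π u v)) ⟩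
        ∑ (λ u → ∑ (λ v → F v Q.* π u v) Q.+ ∑ (λ v → D u v Q.* π u v))
          ≡⟨ ∑-distrib-+ (λ u → ∑ (λ v → F v Q.* π u v)) (λ u → ∑ (λ v → D u v Q.* π u v)) ⟩
        ∑ (λ u → ∑ (λ v → F v Q.* π u v)) Q.+ ∑ (λ u → ∑ (λ v → D u v Q.* π u v))
          ≡⟨ cong₂ Q._+_ (∑∑-target F) (≡.sym (cost≡∑∑ G π)) ⟩
        expectation f μ₂ Q.+ cost G π ∎
        where open ≡-Reasoning

    expectation-≤ : IsLipschitz G f → expectation f μ₁ Q.≤ expectation f μ₂ Q.+ cost G π
    expectation-≤ lipschitz =
      subst₂ Q._≤_ (∑∑-source F) ∑∑-split (∑-mono-≤ (λ u → ∑-mono-≤ (λ v → pointwise u v)))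
      where
      pointwise : ∀ u v → F u Q.* π u v Q.≤ F v Q.* π u v Q.+ D u v Q.* π u v
      pointwise u v = subst (F u Q.* π u v Q.≤_)
        (trans (cong (Q._* π u v) (fromℕ-+ (dist G u v) (f v))) (split (D u v) (F v) (π u v)))
        (*-monoʳ-≤-nonNeg′ (π u v) (proj₁ (proj₁ coupling u v)) (fromℕ-mono-≤ (lipschitz u v)))

    cost-≤ : TightFor G f π → cost G π Q.+ expectation f μ₂ Q.≤ expectation f μ₁
    cost-≤ tight = subst₂ Q._≤_ (trans ∑∑-split (QP.+-comm (expectation f μ₂) (cost G π))) (∑∑-source F)
                     (∑-mono-≤ (λ u → ∑-mono-≤ (λ v → pointwise u v (tight u v))))
      where
      pointwise : ∀ u v → π u v ≡ 0ℚ ⊎ dist G u v + f v ≤ f u →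
                  F v Q.* π u v Q.+ D u v Q.* π u v Q.≤ F u Q.* π u v
      pointwise u v (inj₁ π≡0) rewrite π≡0 = QP.≤-reflexive (vanish (F v) (D u v) (F u))
        where
        vanish : ∀ a b c → a Q.* 0ℚ Q.+ b Q.* 0ℚ ≡ c Q.* 0ℚ
        vanish = solve-∀ ℚ-ring
      pointwise u v (inj₂ tight-uv) = subst (Q._≤ F u Q.* π u v)
        (trans (cong (Q._* π u v) (fromℕ-+ (dist G u v) (f v))) (split (D u v) (F v) (π u v)))
        (*-monoʳ-≤-nonNeg′ (π u v) (proj₁ (proj₁ coupling u v)) (fromℕ-mono-≤ tight-uv))

isW-of-tight-potential : ∀ {n} {G : Graph n} {f : Fin n → ℕ} {μ₁ μ₂ : Fin n → ℚ} {π : Fin n → Fin n → ℚ} →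
  IsLipschitz G f → TightFor G f π → IsCoupling μ₁ μ₂ π →
  IsW G μ₁ μ₂ (expectation f μ₁ - expectation f μ₂)
isW-of-tight-potential {G = G} {f} {π = π} lipschitz tight coupling =
  (λ π′ coupling′ → ≤-+⇒-≤ (expectation-≤ coupling′ {G} {f} lipschitz)) ,
  (λ ε ε>0 → π , coupling , QP.≤-<-trans (+-≤⇒≤- (cost-≤ coupling {G} {f} tight)) (<-+-pos ε>0))

μ-decomposition : ∀ {n} (G : Graph n) p e v →
  μ G p e v ≡ p Q.* 𝟙 ⌊ e ≟ v ⌋ Q.+ (1ℚ - p) Q.* invℕ (deg G e) Q.* 𝟙 (adj G e v)
μ-decomposition G p e v with e ≟ v
... | yes refl rewrite irrefl G e = at-centre p ((1ℚ - p) Q.* invℕ (deg G e))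
  where
  at-centre : ∀ p r → p ≡ p Q.* 1ℚ Q.+ r Q.* 0ℚ
  at-centre = solve-∀ ℚ-ring
... | no _ with adj G e v
...   | true  = at-neighbour p ((1ℚ - p) Q.* invℕ (deg G e))
  where
  at-neighbour : ∀ p r → r ≡ p Q.* 0ℚ Q.+ r Q.* 1ℚ
  at-neighbour = solve-∀ ℚ-ring
...   | false = elsewhere p ((1ℚ - p) Q.* invℕ (deg G e))
  where
  elsewhere : ∀ p r → 0ℚ ≡ p Q.* 0ℚ Q.+ r Q.* 0ℚ
  elsewhere = solve-∀ ℚ-ring

expectation-μ : ∀ {n} (G : Graph n) (f : Fin n → ℕ) p e →
  expectation f (μ G p e) ≡
  p Q.* fromℕ (f e) Q.+ (1ℚ - p) Q.* invℕ (deg G e) Q.* fromℕ (∑ℕ (λ v → if adj G e v then f v else 0))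
expectation-μ {n} G f p e = begin
  ∑ (λ v → F v Q.* μ G p e v)
    ≡⟨ ∑-cong (λ v → trans (cong (F v Q.*_) (μ-decomposition G p e v)) (spread p r (F v) _ _)) ⟩
  ∑ (λ v → p Q.* (F v Q.* 𝟙 ⌊ e ≟ v ⌋) Q.+ r Q.* (F v Q.* 𝟙 (adj G e v)))
    ≡⟨ ∑-distrib-+ (λ v → p Q.* (F v Q.* 𝟙 ⌊ e ≟ v ⌋)) (λ v → r Q.* (F v Q.* 𝟙 (adj G e v))) ⟩
  ∑ (λ v → p Q.* (F v Q.* 𝟙 ⌊ e ≟ v ⌋)) Q.+ ∑ (λ v → r Q.* (F v Q.* 𝟙 (adj G e v)))
    ≡⟨ cong₂ Q._+_ (*-distribˡ-∑ p (λ v → F v Q.* 𝟙 ⌊ e ≟ v ⌋))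
                   (*-distribˡ-∑ r (λ v → F v Q.* 𝟙 (adj G e v))) ⟨
  p Q.* ∑ (λ v → F v Q.* 𝟙 ⌊ e ≟ v ⌋) Q.+ r Q.* ∑ (λ v → F v Q.* 𝟙 (adj G e v))
    ≡⟨ cong₂ (λ a b → p Q.* a Q.+ r Q.* b) at-centre on-neighbours ⟩
  p Q.* F e Q.+ r Q.* fromℕ (∑ℕ (λ v → if adj G e v then f v else 0)) ∎
  where
  open ≡-Reasoning
  F : Fin n → ℚ
  F = fromℕ ∘ f
  r : ℚ
  r = (1ℚ - p) Q.* invℕ (deg G e)
  spread : ∀ p r a b c → a Q.* (p Q.* b Q.+ r Q.* c) ≡ p Q.* (a Q.* b) Q.+ r Q.* (a Q.* c)
  spread = solve-∀ ℚ-ring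
  at-centre : ∑ (λ v → F v Q.* 𝟙 ⌊ e ≟ v ⌋) ≡ F e
  at-centre = trans (∑-δ e (λ v v≢e → trans (cong (λ b → F v Q.* 𝟙 b) (⌊≟⌋-≢ (v≢e ∘ ≡.sym)))
                                            (QP.*-zeroʳ (F v))))
                    (trans (cong (λ b → F e Q.* 𝟙 b) (⌊≟⌋-refl e)) (QP.*-identityʳ (F e)))
  on-neighbours : ∑ (λ v → F v Q.* 𝟙 (adj G e v)) ≡ fromℕ (∑ℕ (λ v → if adj G e v then f v else 0))
  on-neighbours = ≡.sym (trans (fromℕ-∑ℕ (λ v → if adj G e v then f v else 0))
                                (∑-cong (λ v → fromℕ-if (adj G e v) (f v))))

isKappaLLY-of-linear : ∀ {n} (G : Graph n) x y L →
  (∀ p → ½ Q.< p → p Q.< 1ℚ → Σ ℚ λ w → IsW G (μ G p x) (μ G p y) w × κp G x y w ≡ (1ℚ - p) Q.* L) →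
  IsKappaLLY G x y L
isKappaLLY-of-linear G x y L linear ε ε>0 = ½ , QP.positive⁻¹ ½ , λ p ½<p p<1 _ →
  let (w , isW , κ≡) = linear p ½<p p<1 in
  w , isW , subst (λ z → Q.∣ z ∣ Q.< ε) (≡.sym (vanishes w p p<1 κ≡)) ε>0
  where
  vanishes : ∀ w p → p Q.< 1ℚ → κp G x y w ≡ (1ℚ - p) Q.* L → κp G x y w Q.* recip (1ℚ - p) - L ≡ 0ℚ
  vanishes w p p<1 κ≡ = begin
    κp G x y w Q.* recip (1ℚ - p) - L            ≡⟨ cong (λ κ → κ Q.* recip (1ℚ - p) - L) κ≡ ⟩
    (1ℚ - p) Q.* L Q.* recip (1ℚ - p) - L        ≡⟨ regroup (1ℚ - p) L (recip (1ℚ - p)) ⟩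
    L Q.* ((1ℚ - p) Q.* recip (1ℚ - p)) - L      ≡⟨ cong (λ z → L Q.* z - L) (recip-inverseʳ (1ℚ - p) 1-p≢0) ⟩
    L Q.* 1ℚ - L                                 ≡⟨ cancel L ⟩
    0ℚ                                           ∎
    where
    open ≡-Reasoning
    regroup : ∀ a L b → a Q.* L Q.* b - L ≡ L Q.* (a Q.* b) - L
    regroup = solve-∀ ℚ-ring
    cancel : ∀ L → L Q.* 1ℚ - L ≡ 0ℚ
    cancel = solve-∀ ℚ-ring
    1-p≢0 : 1ℚ - p ≢ 0ℚ
    1-p≢0 1-p≡0 = QP.<-irrefl (≡.sym 1-p≡0) (0<-⇐< p<1)

-- Vertex connectivity

true≢false : true ≢ false
true≢false ()

StaysConnected : ∀ {n} → Graph n → Subset n → Set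
StaysConnected {n} G S = ∀ u v → S u ≡ false → S v ≡ false → reach (removeAdj G S) n u v ≡ true

module _ {n} (G : Graph n) (S : Subset n) where

  removeAdj-sym : ∀ a b → removeAdj G S a b ≡ removeAdj G S b a
  removeAdj-sym a b = cong₂ _∧_ (Graph.sym G a b) (BoolP.∧-comm (not (S a)) (not (S b)))

  edge-survives : ∀ {u v} → adj G u v ≡ true → S u ≡ false → S v ≡ false → removeAdj G S u v ≡ true
  edge-survives uv Su Sv rewrite uv | Su | Sv = refl

complete⇒¬Disconnects : ∀ {n} {G : Graph n} {S} → Complete G → ¬ Disconnects G S
complete⇒¬Disconnects {suc n} {G} {S} complete (u , v , Su , Sv , ¬reach) =
  true≢false (trans (≡.sym (walk⇒reach {A = removeAdj G S} (weaken {l = 1} {suc n} (s≤s z≤n) one-step))) ¬reach)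
  where
  one-step : Walk (removeAdj G S) 1 u v
  one-step = stay-or-step (Sum.map₂ (λ u≢v → edge-survives G S (complete u v u≢v) Su Sv) (toSum (u ≟ v)))

isConnectivity-complete : ∀ {n} {G : Graph n} → Complete G → IsConnectivity G (ℕ.pred n)
isConnectivity-complete complete = (λ _ → refl) , (λ incomplete → ⊥-elim (incomplete complete))

isConnectivity-of-separator : ∀ {n} {G : Graph n} {k} S₀ → Disconnects G S₀ → size S₀ ≡ k →
  (∀ S → size S < k → StaysConnected G S) → IsConnectivity G k
isConnectivity-of-separator {G = G} {k} S₀ separates size≡k connected =
  (λ complete → ⊥-elim (complete⇒¬Disconnects {G = G} {S₀} complete separates)) ,
  (λ _ → (S₀ , separates , size≡k) , minimal)
  where
  minimal : ∀ S → Disconnects G S → k ≤ size S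
  minimal S (u , v , Su , Sv , ¬reach) with k ℕ.≤? size S
  ... | yes k≤ = k≤
  ... | no  k≰ = ⊥-elim (true≢false (trans (≡.sym (connected S (ℕP.≰⇒> k≰) u v Su Sv)) ¬reach))

neighbourhood-separates : ∀ {n} (G : Graph n) {u v} → u ≢ v → adj G u v ≡ false → Disconnects G (adj G u)
neighbourhood-separates {n} G {u} {v} u≢v ¬uv = u , v , irrefl G u , ¬uv , isolated⇒unreachable isolated u≢v n
  where
  isolated : ∀ z → removeAdj G (adj G u) u z ≡ false
  isolated z rewrite irrefl G u with adj G u z
  ... | true  = refl
  ... | false = refl

-- The pattern graph

-- Two vertices of the blow-up are adjacent iff they are distinct and their parts are linked;
-- apart lists the pairs of parts that are not linked, each once.
data Part : Set where
  X Y C A₁ A₂ B R : Part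

apart : Part → Part → Bool
apart X  X  = true
apart Y  Y  = true
apart X  B  = true
apart X  R  = true
apart Y  A₁ = true
apart Y  A₂ = true
apart Y  R  = true
apart A₁ B  = true
apart _  _  = false

linked : Part → Part → Bool
linked K L = not (apart K L ∨ apart L K)

linked-sym : ∀ K L → linked K L ≡ linked L K
linked-sym K L = cong not (BoolP.∨-comm (apart K L) (apart L K))

inner hub stays isX isY isA isB : Part → Bool
inner X = false
inner Y = false
inner _ = true
hub C  = true
hub A₂ = true
hub R  = true
hub _  = false
stays X = true
stays Y = true
stays C = true
stays _ = false
isX X = true
isX _ = false
isY Y = true
isY _ = false
isA A₁ = true
isA A₂ = true
isA _  = false
isB B = true
isB _ = false

outer : Part → Bool
outer K = inner K ∧ (linked X K ∨ linked Y K)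

-- φ K is the distance from any vertex of part K to {y} ∪ B.
φ : Part → ℕ
φ X  = 1
φ Y  = 0
φ C  = 1
φ A₁ = 2
φ A₂ = 1
φ B  = 0
φ R  = 1

parts : List Part
parts = X ∷ Y ∷ C ∷ A₁ ∷ A₂ ∷ B ∷ R ∷ []

∈-parts : ∀ K → K ∈ parts
∈-parts X  = here refl
∈-parts Y  = there (here refl)
∈-parts C  = there (there (here refl))
∈-parts A₁ = there (there (there (here refl)))
∈-parts A₂ = there (there (there (there (here refl))))
∈-parts B  = there (there (there (there (there (here refl)))))
∈-parts R  = there (there (there (there (there (there (here refl))))))

by-cases : {P : Part → Set} (P? : Decidable P) {_ : True (All.all? P? parts)} → ∀ K → P K
by-cases P? {checked} K = All.lookup (toWitness checked) (∈-parts K)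

by-cases₂ : {P : Part → Part → Set} (P? : ∀ K → Decidable (P K))
  {_ : True (All.all? (λ K → All.all? (P? K) parts) parts)} → ∀ K L → P K L
by-cases₂ P? {checked} K L = All.lookup (All.lookup (toWitness checked) (∈-parts K)) (∈-parts L)

hub-linked : ∀ K L → inner K ≡ true → hub L ≡ true → linked K L ≡ true
hub-linked = by-cases₂ λ K L → (inner K Bool.≟ true) →-dec (hub L Bool.≟ true) →-dec (linked K L Bool.≟ true)

non-hub-linked : ∀ K → inner K ≡ true → hub K ≡ false → linked K X ≡ true ⊎ linked K Y ≡ true
non-hub-linked = by-cases λ K → (inner K Bool.≟ true) →-dec (hub K Bool.≟ false) →-dec
  ((linked K X Bool.≟ true) ⊎-dec (linked K Y Bool.≟ true))

inner⇒¬isX : ∀ K → inner K ≡ true → isX K ≡ false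
inner⇒¬isX = by-cases λ K → (inner K Bool.≟ true) →-dec (isX K Bool.≟ false)

inner⇒¬isY : ∀ K → inner K ≡ true → isY K ≡ false
inner⇒¬isY = by-cases λ K → (inner K Bool.≟ true) →-dec (isY K Bool.≟ false)

outer-linked : ∀ K → outer K ≡ true → linked X K ≡ true ⊎ linked Y K ≡ true
outer-linked = by-cases λ K → (outer K Bool.≟ true) →-dec ((linked X K Bool.≟ true) ⊎-dec (linked Y K Bool.≟ true))

outer⇒inner : ∀ K → outer K ≡ true → inner K ≡ true
outer⇒inner = by-cases λ K → (outer K Bool.≟ true) →-dec (inner K Bool.≟ true)

isB⇒¬linked-X : ∀ K → isB K ≡ true → linked X K ≡ false
isB⇒¬linked-X = by-cases λ K → (isB K Bool.≟ true) →-dec (linked X K Bool.≟ false)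

φ-far : ∀ K L → φ K ≤ 2 + φ L
φ-far = by-cases₂ λ K L → φ K ℕ.≤? 2 + φ L

φ-near : ∀ K L → linked K L ≡ true → φ K ≤ 1 + φ L
φ-near = by-cases₂ λ K L → (linked K L Bool.≟ true) →-dec (φ K ℕ.≤? 1 + φ L)

x→y-tight : ∀ K L → isX K ∧ isY L ≡ true → linked K L ≡ true × 1 + φ L ≤ φ K
x→y-tight = by-cases₂ λ K L → (isX K ∧ isY L Bool.≟ true) →-dec
  (linked K L Bool.≟ true) ×-dec (1 + φ L ℕ.≤? φ K)

a→b-tight : ∀ K L → isA K ∧ isB L ≡ true →
  (linked K L ≡ true × 1 + φ L ≤ φ K) ⊎ (inner K ≡ true × inner L ≡ true × 2 + φ L ≤ φ K)
a→b-tight = by-cases₂ λ K L → (isA K ∧ isB L Bool.≟ true) →-dec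
  (((linked K L Bool.≟ true) ×-dec (1 + φ L ℕ.≤? φ K)) ⊎-dec
   ((inner K Bool.≟ true) ×-dec (inner L Bool.≟ true) ×-dec (2 + φ L ℕ.≤? φ K)))

balance-x : ∀ K → 𝟙 (stays K) Q.+ 𝟙 (isA K) ≡ 𝟙 (isX K) Q.+ 𝟙 (linked X K)
balance-x = by-cases λ K → 𝟙 (stays K) Q.+ 𝟙 (isA K) QP.≟ 𝟙 (isX K) Q.+ 𝟙 (linked X K)

balance-y : ∀ K → 𝟙 (stays K) Q.+ 𝟙 (isB K) ≡ 𝟙 (isY K) Q.+ 𝟙 (linked Y K)
balance-y = by-cases λ K → 𝟙 (stays K) Q.+ 𝟙 (isB K) QP.≟ 𝟙 (isY K) Q.+ 𝟙 (linked Y K)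

VecAll-replicate : ∀ {A : Set} {P : A → Set} k {x} → P x → VecAll.All P (replicate k x)
VecAll-replicate zero    px = VecAll.[]
VecAll-replicate (suc k) px = px VecAll.∷ VecAll-replicate k px

module BlowUp (c m a : ℕ) where

  rest : Vec Part (c + (m + (a + ((m + a) + m))))
  rest = replicate c C ++ replicate m A₁ ++ replicate a A₂ ++ replicate (m + a) B ++ replicate m R

  order degree : ℕ
  order  = 2 + (c + (m + (a + ((m + a) + m))))
  degree = suc (c + (m + a))

  part : Fin order → Part
  part = lookup (X Vec.∷ Y Vec.∷ rest)

  adjacency : Fin order → Fin order → Bool
  adjacency u v = linked (part u) (part v) ∧ not ⌊ u ≟ v ⌋

  G : Graph order
  G = record
    { adj    = adjacency
    ; sym    = λ u v → cong₂ (λ b e → b ∧ not e) (linked-sym (part u) (part v)) (⌊≟⌋-sym u v)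
    ; irrefl = λ u → trans (cong (λ e → linked (part u) (part u) ∧ not e) (⌊≟⌋-refl u)) (BoolP.∧-zeroʳ _)
    }

  x y : Fin order
  x = zero
  y = suc zero

  ∑ℕ-by-part : ∀ (g : Part → ℕ) →
    ∑ℕ (g ∘ part) ≡ g X + (g Y + (c * g C + (m * g A₁ + (a * g A₂ + ((m + a) * g B + m * g R)))))
  ∑ℕ-by-part g = cong (λ s → g X + (g Y + s))
    (trans (∑ℕ-lookup-replicate-++ g c C _) (cong (c * g C +_)
    (trans (∑ℕ-lookup-replicate-++ g m A₁ _) (cong (m * g A₁ +_)
    (trans (∑ℕ-lookup-replicate-++ g a A₂ _) (cong (a * g A₂ +_)
    (trans (∑ℕ-lookup-replicate-++ g (m + a) B _) (cong ((m + a) * g B +_)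
    (∑ℕ-lookup-replicate g m R)))))))))

  size-by-part : ∀ (T : Part → Bool) → size (T ∘ part) ≡
    ind (T X) + (ind (T Y) + (c * ind (T C) + (m * ind (T A₁) + (a * ind (T A₂) + ((m + a) * ind (T B) + m * ind (T R))))))
  size-by-part T = trans (size≡∑ℕ (T ∘ part)) (∑ℕ-by-part (ind ∘ T))

  rest-inner : VecAll.All (λ K → inner K ≡ true) rest
  rest-inner = VecAllP.++⁺ (VecAll-replicate c refl) (VecAllP.++⁺ (VecAll-replicate m refl)
    (VecAllP.++⁺ (VecAll-replicate a refl) (VecAllP.++⁺ (VecAll-replicate (m + a) refl) (VecAll-replicate m refl))))

  data Vertex : Fin order → Set where
    vertex-x     : Vertex x
    vertex-y     : Vertex y
    inner-vertex : ∀ {u} → inner (part u) ≡ true → Vertex u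

  vertex : ∀ u → Vertex u
  vertex zero          = vertex-x
  vertex (suc zero)    = vertex-y
  vertex (suc (suc w)) = inner-vertex (VecAllP.lookup⁺ rest-inner w)

  adj⇒linked : ∀ u v → adj G u v ≡ true → linked (part u) (part v) ≡ true
  adj⇒linked u v uv with linked (part u) (part v)
  ... | true  = refl
  ... | false = uv

  linked⇒adj : ∀ u v → linked (part u) (part v) ≡ true → u ≢ v → adj G u v ≡ true
  linked⇒adj u v uv u≢v rewrite uv | ⌊≟⌋-≢ u≢v = refl

  adj-x : ∀ v → adj G x v ≡ linked X (part v)
  adj-x zero    = refl
  adj-x (suc v) = BoolP.∧-identityʳ _

  adj-y : ∀ v → adj G y v ≡ linked Y (part v)
  adj-y zero          = refl
  adj-y (suc zero)    = refl
  adj-y (suc (suc v)) = BoolP.∧-identityʳ _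

  deg-x : deg G x ≡ degree
  deg-x = trans (size-cong adj-x) (trans (size-by-part (linked X)) count)
    where
    count : 1 + (c * 1 + (m * 1 + (a * 1 + ((m + a) * 0 + m * 0)))) ≡ suc (c + (m + a))
    count = solve (c ∷ m ∷ a ∷ [])

  deg-y : deg G y ≡ degree
  deg-y = trans (size-cong adj-y) (trans (size-by-part (linked Y)) count)
    where
    count : 1 + (c * 1 + (m * 0 + (a * 0 + ((m + a) * 1 + m * 0)))) ≡ suc (c + (m + a))
    count = solve (c ∷ m ∷ a ∷ [])

  x≢inner : ∀ {u} → inner (part u) ≡ true → x ≢ u
  x≢inner () refl

  y≢inner : ∀ {u} → inner (part u) ≡ true → y ≢ u
  y≢inner () refl

  ⌊x≟⌋≡isX : ∀ u → ⌊ x ≟ u ⌋ ≡ isX (part u)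
  ⌊x≟⌋≡isX u with vertex u
  ... | vertex-x       = refl
  ... | vertex-y       = refl
  ... | inner-vertex i = trans (⌊≟⌋-≢ (x≢inner i)) (≡.sym (inner⇒¬isX (part u) i))

  ⌊y≟⌋≡isY : ∀ u → ⌊ y ≟ u ⌋ ≡ isY (part u)
  ⌊y≟⌋≡isY u with vertex u
  ... | vertex-x       = refl
  ... | vertex-y       = refl
  ... | inner-vertex i = trans (⌊≟⌋-≢ (y≢inner i)) (≡.sym (inner⇒¬isY (part u) i))

  neighbour-of-x : ∀ v → adj G x v ≡ true → v ≡ y ⊎ inner (part v) ≡ true
  neighbour-of-x v xv with vertex v
  neighbour-of-x _ () | vertex-x
  ... | vertex-y       = inj₁ refl
  ... | inner-vertex i = inj₂ i

  neighbour-of-y : ∀ v → adj G y v ≡ true → v ≡ x ⊎ inner (part v) ≡ true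
  neighbour-of-y v yv with vertex v
  ... | vertex-x       = inj₁ refl
  neighbour-of-y _ () | vertex-y
  ... | inner-vertex i = inj₂ i

  size-isX : size (isX ∘ part) ≡ 1
  size-isX = trans (size-by-part isX) (solve (c ∷ m ∷ a ∷ []))

  size-isY : size (isY ∘ part) ≡ 1
  size-isY = trans (size-by-part isY) (solve (c ∷ m ∷ a ∷ []))

  size-isA : size (isA ∘ part) ≡ m + a
  size-isA = trans (size-by-part isA) count
    where
    count : c * 0 + (m * 1 + (a * 1 + ((m + a) * 0 + m * 0))) ≡ m + a
    count = solve (c ∷ m ∷ a ∷ [])

  size-isB : size (isB ∘ part) ≡ m + a
  size-isB = trans (size-by-part isB) count
    where
    count : c * 0 + (m * 0 + (a * 0 + ((m + a) * 1 + m * 0))) ≡ m + a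
    count = solve (c ∷ m ∷ a ∷ [])

  size-hub : size (hub ∘ part) ≡ c + (m + a)
  size-hub = trans (size-by-part hub) count
    where
    count : c * 1 + (m * 0 + (a * 1 + ((m + a) * 0 + m * 1))) ≡ c + (m + a)
    count = solve (c ∷ m ∷ a ∷ [])

  size-outer : size (outer ∘ part) ≡ c + (m + a) + (m + a)
  size-outer = trans (size-by-part outer) count
    where
    count : c * 1 + (m * 1 + (a * 1 + ((m + a) * 1 + m * 0))) ≡ c + (m + a) + (m + a)
    count = solve (c ∷ m ∷ a ∷ [])

  hub-adjacent : ∀ h u → hub (part h) ≡ true → inner (part u) ≡ true → u ≡ h ⊎ adj G u h ≡ true
  hub-adjacent h u Hh Iu = Sum.map₂ (linked⇒adj u h (hub-linked (part u) (part h) Iu Hh)) (toSum (u ≟ h))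

  inner-dist≤2 : 1 ≤ m + a → ∀ {u v} → inner (part u) ≡ true → inner (part v) ≡ true → dist G u v ≤ 2
  inner-dist≤2 1≤m+a {u} {v} Iu Iv
    with 1≤size⇒∃ {T = hub ∘ part} (subst (1 ≤_) (≡.sym size-hub) (ℕP.≤-trans 1≤m+a (ℕP.m≤n+m (m + a) c)))
  ... | h , Hh = dist≤ G {2} {u} {v}
    (stay-or-step (hub-adjacent h u Hh Iu) ◅◅ reverse (Graph.sym G) (stay-or-step (hub-adjacent h v Hh Iv)))

  module Connectivity (1≤m+a : 1 ≤ m + a) where

    4≤order : 4 ≤ order
    4≤order = s≤s (s≤s (ℕP.≤-trans (ℕP.+-mono-≤ 1≤m+a 1≤m+a)
                                    (ℕP.≤-trans (ℕP.m≤n+m _ (c + m)) (ℕP.≤-reflexive regroup))))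
      where
      regroup : c + m + ((m + a) + (m + a)) ≡ c + (m + (a + ((m + a) + m)))
      regroup = solve (c ∷ m ∷ a ∷ [])

    degree≤size-outer : degree ≤ size (outer ∘ part)
    degree≤size-outer =
      subst₂ _≤_ (ℕP.+-comm (c + (m + a)) 1) (≡.sym size-outer) (ℕP.+-monoʳ-≤ (c + (m + a)) 1≤m+a)

    neighbourhood-of-x-separates : Disconnects G (adj G x)
    neighbourhood-of-x-separates with 1≤size⇒∃ {T = isB ∘ part} (subst (1 ≤_) (≡.sym size-isB) 1≤m+a)
    ... | b , Bb = neighbourhood-separates G {x} {b} (x≢B Bb) (trans (adj-x b) (isB⇒¬linked-X (part b) Bb))
      where
      x≢B : ∀ {u} → isB (part u) ≡ true → x ≢ u
      x≢B () refl

    module _ (S : Subset order) (small : size S < degree) where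

      private
        H : Fin order → Fin order → Bool
        H = removeAdj G S

      surviving : ∀ {u v} → u ≡ v ⊎ adj G u v ≡ true → S u ≡ false → S v ≡ false → Walk H 1 u v
      surviving (inj₁ refl) _  _  = stay
      surviving (inj₂ uv)   Su Sv = edge (edge-survives G S uv Su Sv)

      survivor-in : ∀ T → degree ≤ size T → ∃ λ w → T w ≡ true × S w ≡ false
      survivor-in T big = size<⇒∃∉ (ℕP.<-≤-trans small big)

      module _ {h} (Hh : hub (part h) ≡ true) (Sh : S h ≡ false) where

        inner-to-hub : ∀ u → inner (part u) ≡ true → S u ≡ false → Walk H 1 u h
        inner-to-hub u Iu Su = surviving (hub-adjacent h u Hh Iu) Su Sh

        end-to-hub : ∀ {e e′} → S e ≡ false → deg G e ≡ degree → adj G e e′ ≡ true →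
          (∀ v → adj G e v ≡ true → v ≡ e′ ⊎ inner (part v) ≡ true) →
          (∀ w → outer (part w) ≡ true → adj G e w ≡ true ⊎ adj G e′ w ≡ true) →
          Walk H 3 e h
        end-to-hub {e} {e′} Se deg-e ee′ neighbour outer-adjacent
          with survivor-in (adj G e) (ℕP.≤-reflexive (≡.sym deg-e))
        ... | z , ez , Sz with neighbour z ez
        ...   | inj₂ Iz    = weaken (ℕP.n≤1+n 2) (step (edge-survives G S ez Se Sz) (inner-to-hub z Iz Sz))
        ...   | inj₁ refl
          with survivor-in (outer ∘ part) degree≤size-outer
        ...     | w , Ow , Sw with outer-adjacent w Ow
        ...       | inj₁ ew  = weaken (ℕP.n≤1+n 2)
                                 (step (edge-survives G S ew Se Sw) (inner-to-hub w (outer⇒inner (part w) Ow) Sw))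
        ...       | inj₂ e′w = step (edge-survives G S ee′ Se Sz)
                                 (step (edge-survives G S e′w Sz Sw) (inner-to-hub w (outer⇒inner (part w) Ow) Sw))

        to-hub : ∀ u → S u ≡ false → Walk H 3 u h
        to-hub u Su with vertex u
        ... | vertex-x = end-to-hub {x} {y} Su deg-x refl neighbour-of-x outer-adjacent-x
          where
          outer-adjacent-x : ∀ w → outer (part w) ≡ true → adj G x w ≡ true ⊎ adj G y w ≡ true
          outer-adjacent-x w Ow = Sum.map (trans (adj-x w)) (trans (adj-y w)) (outer-linked (part w) Ow)
        ... | vertex-y = end-to-hub {y} {x} Su deg-y refl neighbour-of-y outer-adjacent-y
          where
          outer-adjacent-y : ∀ w → outer (part w) ≡ true → adj G y w ≡ true ⊎ adj G x w ≡ true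
          outer-adjacent-y w Ow = Sum.swap (Sum.map (trans (adj-x w)) (trans (adj-y w)) (outer-linked (part w) Ow))
        ... | inner-vertex Iu = weaken (s≤s z≤n) (inner-to-hub u Iu Su)

        via-hub : ∀ u v → S u ≡ false → S v ≡ false → Walk H order u v
        via-hub u v Su Sv with vertex u | vertex v
        ... | inner-vertex Iu | _ = weaken 4≤order (inner-to-hub u Iu Su ◅◅ reverse (removeAdj-sym G S) (to-hub v Sv))
        ... | _ | inner-vertex Iv = weaken 4≤order (to-hub u Su ◅◅ reverse (removeAdj-sym G S) (inner-to-hub v Iv Sv))
        ... | vertex-x | vertex-x = stay
        ... | vertex-y | vertex-y = stay
        ... | vertex-x | vertex-y = weaken (ℕP.≤-trans (s≤s z≤n) 4≤order) (surviving (inj₂ refl) Su Sv)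
        ... | vertex-y | vertex-x = weaken (ℕP.≤-trans (s≤s z≤n) 4≤order) (surviving (inj₂ refl) Su Sv)

      -- S has fewer than 1 + (c + m + a) elements, so then it consists of the hubs only.
      without-hubs : (hub ∘ part) ⊆ S → ∀ u v → S u ≡ false → S v ≡ false → Walk H order u v
      without-hubs hubs⊆S u v Su Sv = weaken 4≤order (to-x u Su ◅◅ reverse (removeAdj-sym G S) (to-x v Sv))
        where
        S⊆hubs : S ⊆ (hub ∘ part)
        S⊆hubs = size≤⇒⊇ hubs⊆S (subst (size S ≤_) (≡.sym size-hub) (ℕP.≤-pred small))
        non-hub-survives : ∀ u → hub (part u) ≡ false → S u ≡ false
        non-hub-survives u ¬Hu with S u in Su
        ... | false = refl
        ... | true  = ≡.sym (trans (≡.sym ¬Hu) (S⊆hubs u Su))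
        survivor-is-non-hub : ∀ u → S u ≡ false → hub (part u) ≡ false
        survivor-is-non-hub u Su with hub (part u) in Hu
        ... | false = refl
        ... | true  = trans (≡.sym (hubs⊆S u Hu)) Su
        x↔y : Walk H 1 y x
        x↔y = surviving (inj₂ refl) (non-hub-survives y refl) (non-hub-survives x refl)
        to-x : ∀ u → S u ≡ false → Walk H 2 u x
        to-x u Su with vertex u
        ... | vertex-x = stay
        ... | vertex-y = weaken (s≤s z≤n) x↔y
        ... | inner-vertex Iu with non-hub-linked (part u) Iu (survivor-is-non-hub u Su)
        ...   | inj₁ ux = weaken (s≤s z≤n)
                            (edge (edge-survives G S (linked⇒adj u x ux (x≢inner Iu ∘ ≡.sym)) Su (non-hub-survives x refl)))
        ...   | inj₂ uy = step (edge-survives G S (linked⇒adj u y uy (y≢inner Iu ∘ ≡.sym)) Su (non-hub-survives y refl))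
                            x↔y

      stays-connected : StaysConnected G S
      stays-connected u v Su Sv with FinP.any? (λ h → (hub (part h) Bool.≟ true) ×-dec (S h Bool.≟ false))
      ... | yes (h , Hh , Sh) = walk⇒reach (via-hub Hh Sh u v Su Sv)
      ... | no  ∄            = walk⇒reach (without-hubs hubs⊆S u v Su Sv)
        where
        hubs⊆S : (hub ∘ part) ⊆ S
        hubs⊆S h Hh with S h in Sh
        ... | true  = refl
        ... | false = ⊥-elim (∄ (h , Hh , Sh))

    isConnectivity : IsConnectivity G degree
    isConnectivity = isConnectivity-of-separator {G = G} (adj G x) neighbourhood-of-x-separates deg-x stays-connected

  dist-xy : dist G x y ≡ 1
  dist-xy = ℕP.≤-antisym (adjacent⇒dist≤1 G {x} {y} refl) (1≤dist G {x} {y} (λ ()))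

  φ-lipschitz : IsLipschitz G (φ ∘ part)
  φ-lipschitz = lipschitz-of-steps G (φ ∘ part) (λ u v → φ-far (part u) (part v))
    (λ u v uv → φ-near (part u) (part v) (adj⇒linked u v uv))

  potential-near-x : ∑ℕ (λ v → if adj G x v then φ (part v) else 0) ≡ c + (m + m + a)
  potential-near-x =
    trans (∑ℕ-cong (λ v → cong (λ b → if b then φ (part v) else 0) (adj-x v)))
          (trans (∑ℕ-by-part (λ K → if linked X K then φ K else 0)) count)
    where
    count : c * 1 + (m * 2 + (a * 1 + ((m + a) * 0 + m * 0))) ≡ c + (m + m + a)
    count = solve (c ∷ m ∷ a ∷ [])

  potential-near-y : ∑ℕ (λ v → if adj G y v then φ (part v) else 0) ≡ 1 + c
  potential-near-y =
    trans (∑ℕ-cong (λ v → cong (λ b → if b then φ (part v) else 0) (adj-y v)))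
          (trans (∑ℕ-by-part (λ K → if linked Y K then φ K else 0)) count)
    where
    count : 1 + (c * 1 + (m * 0 + (a * 0 + ((m + a) * 0 + m * 0)))) ≡ 1 + c
    count = solve (c ∷ m ∷ a ∷ [])

  tight-along-edge : ∀ u v → u ≢ v → linked (part u) (part v) ≡ true × 1 + φ (part v) ≤ φ (part u) →
    dist G u v + φ (part v) ≤ φ (part u)
  tight-along-edge u v u≢v (uv , drop) =
    ℕP.≤-trans (ℕP.+-monoˡ-≤ (φ (part v)) (adjacent⇒dist≤1 G {u} {v} (linked⇒adj u v uv u≢v))) drop

  tight-through-hub : 1 ≤ m + a → ∀ u v →
    inner (part u) ≡ true × inner (part v) ≡ true × 2 + φ (part v) ≤ φ (part u) → dist G u v + φ (part v) ≤ φ (part u)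
  tight-through-hub 1≤m+a u v (Iu , Iv , drop) =
    ℕP.≤-trans (ℕP.+-monoˡ-≤ (φ (part v)) (inner-dist≤2 1≤m+a {u} {v} Iu Iv)) drop

  module Curvature (p : ℚ) (½<p : ½ Q.< p) (p<1 : p Q.< 1ℚ) where

    q : ℚ
    q = (1ℚ - p) Q.* invℕ degree

    stay-pair xy-pair ab-pair : Fin order → Fin order → Bool
    stay-pair u v = ⌊ u ≟ v ⌋ ∧ stays (part u)
    xy-pair   u v = isX (part u) ∧ isY (part v)
    ab-pair   u v = isA (part u) ∧ isB (part v)

    share : ℚ
    share = q Q.* invℕ (m + a)

    plan : Fin order → Fin order → ℚ
    plan u v = q Q.* 𝟙 (stay-pair u v) Q.+ (p - q) Q.* 𝟙 (xy-pair u v) Q.+ share Q.* 𝟙 (ab-pair u v)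

    0≤1-p : 0ℚ Q.≤ 1ℚ - p
    0≤1-p = QP.<⇒≤ (0<-⇐< p<1)

    0≤q : 0ℚ Q.≤ q
    0≤q = 0≤* 0≤1-p (invℕ-nonNeg degree)

    q≤1-p : q Q.≤ 1ℚ - p
    q≤1-p = subst (q Q.≤_) (QP.*-identityʳ (1ℚ - p))
      (QP.*-monoˡ-≤-nonNeg (1ℚ - p) {{Q.nonNegative 0≤1-p}} (invℕ≤1 degree))

    q<p : q Q.< p
    q<p = QP.≤-<-trans q≤1-p (QP.<-trans (QP.+-monoʳ-< 1ℚ (QP.neg-antimono-< ½<p)) ½<p)

    share≤q : share Q.≤ q
    share≤q = subst (share Q.≤_) (QP.*-identityʳ q)
      (QP.*-monoˡ-≤-nonNeg q {{Q.nonNegative 0≤q}} (invℕ≤1 (m + a)))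

    plan-bounded : ∀ u v → 0ℚ Q.≤ plan u v × plan u v Q.≤ 1ℚ
    plan-bounded u v =
      QP.+-mono-≤ (QP.+-mono-≤ (proj₁ st) (proj₁ xy)) (proj₁ ab) ,
      QP.≤-trans (QP.+-mono-≤ (QP.+-mono-≤ (proj₂ st) (proj₂ xy)) (QP.≤-trans (proj₂ ab) share≤q))
        (QP.≤-trans (QP.≤-reflexive (collect p q)) (subst (p Q.+ q Q.≤_) (complement p) (QP.+-monoʳ-≤ p q≤1-p)))
      where
      st   = *𝟙-bounds q (stay-pair u v) 0≤q
      xy   = *𝟙-bounds (p - q) (xy-pair u v) (QP.<⇒≤ (0<-⇐< q<p))
      ab   = *𝟙-bounds share (ab-pair u v) (0≤* 0≤q (invℕ-nonNeg (m + a)))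
      collect : ∀ p q → q Q.+ (p - q) Q.+ q ≡ p Q.+ q
      collect = solve-∀ ℚ-ring
      complement : ∀ p → p Q.+ (1ℚ - p) ≡ 1ℚ
      complement = solve-∀ ℚ-ring

    spread : ∀ b → (b ≡ true → 1 ≤ m + a) → share Q.* (𝟙 b Q.* fromℕ (m + a)) ≡ q Q.* 𝟙 b
    spread false _     = vanish q (invℕ (m + a)) (fromℕ (m + a))
      where
      vanish : ∀ q i M → q Q.* i Q.* (0ℚ Q.* M) ≡ q Q.* 0ℚ
      vanish = solve-∀ ℚ-ring
    spread true  1≤m+a = trans (regroup q (invℕ (m + a)) (fromℕ (m + a))) (cong (q Q.*_) (fromℕ*invℕ (1≤m+a refl)))
      where
      regroup : ∀ q i M → q Q.* i Q.* (1ℚ Q.* M) ≡ q Q.* (M Q.* i)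
      regroup = solve-∀ ℚ-ring

    μ-x : ∀ u → μ G p x u ≡ p Q.* 𝟙 (isX (part u)) Q.+ q Q.* 𝟙 (linked X (part u))
    μ-x u = trans (μ-decomposition G p x u)
      (trans (cong₂ (λ i l → p Q.* 𝟙 i Q.+ (1ℚ - p) Q.* invℕ (deg G x) Q.* 𝟙 l) (⌊x≟⌋≡isX u) (adj-x u))
             (cong (λ d → p Q.* 𝟙 (isX (part u)) Q.+ (1ℚ - p) Q.* invℕ d Q.* 𝟙 (linked X (part u))) deg-x))

    μ-y : ∀ v → μ G p y v ≡ p Q.* 𝟙 (isY (part v)) Q.+ q Q.* 𝟙 (linked Y (part v))
    μ-y v = trans (μ-decomposition G p y v)
      (trans (cong₂ (λ i l → p Q.* 𝟙 i Q.+ (1ℚ - p) Q.* invℕ (deg G y) Q.* 𝟙 l) (⌊y≟⌋≡isY v) (adj-y v))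
             (cong (λ d → p Q.* 𝟙 (isY (part v)) Q.+ (1ℚ - p) Q.* invℕ d Q.* 𝟙 (linked Y (part v))) deg-y))

    row-sum : ∀ u → ∑ (plan u) ≡ μ G p x u
    row-sum u = begin
      ∑ (plan u)
        ≡⟨ ∑-indicators q (p - q) share (stay-pair u) (xy-pair u) (ab-pair u)
             (∑-𝟙-diagonalʳ (stays ∘ part) u)
             (trans (∑-𝟙-∧ˡ (isX (part u)) (isY ∘ part)) (cong (λ s → 𝟙 (isX (part u)) Q.* fromℕ s) size-isY))
             (trans (∑-𝟙-∧ˡ (isA (part u)) (isB ∘ part)) (cong (λ s → 𝟙 (isA (part u)) Q.* fromℕ s) size-isB)) ⟩
      q Q.* 𝟙 (stays (part u)) Q.+ (p - q) Q.* (𝟙 (isX (part u)) Q.* 1ℚ)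
        Q.+ share Q.* (𝟙 (isA (part u)) Q.* fromℕ (m + a))
        ≡⟨ cong (q Q.* 𝟙 (stays (part u)) Q.+ (p - q) Q.* (𝟙 (isX (part u)) Q.* 1ℚ) Q.+_)
             (spread (isA (part u)) (λ Au → subst (1 ≤_) size-isA (1≤size {T = isA ∘ part} u Au))) ⟩
      q Q.* 𝟙 (stays (part u)) Q.+ (p - q) Q.* (𝟙 (isX (part u)) Q.* 1ℚ) Q.+ q Q.* 𝟙 (isA (part u))
        ≡⟨ balance-identity p q (𝟙 (stays (part u))) (𝟙 (isX (part u))) (𝟙 (isA (part u))) (𝟙 (linked X (part u)))
             (balance-x (part u)) ⟩
      p Q.* 𝟙 (isX (part u)) Q.+ q Q.* 𝟙 (linked X (part u))
        ≡⟨ μ-x u ⟨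
      μ G p x u ∎
      where open ≡-Reasoning

    column-sum : ∀ v → ∑ (λ u → plan u v) ≡ μ G p y v
    column-sum v = begin
      ∑ (λ u → plan u v)
        ≡⟨ ∑-indicators q (p - q) share (λ u → stay-pair u v) (λ u → xy-pair u v) (λ u → ab-pair u v)
             (∑-𝟙-diagonalˡ (stays ∘ part) v)
             (trans (∑-𝟙-∧ʳ (isY (part v)) (isX ∘ part)) (cong (λ s → 𝟙 (isY (part v)) Q.* fromℕ s) size-isX))
             (trans (∑-𝟙-∧ʳ (isB (part v)) (isA ∘ part)) (cong (λ s → 𝟙 (isB (part v)) Q.* fromℕ s) size-isA)) ⟩
      q Q.* 𝟙 (stays (part v)) Q.+ (p - q) Q.* (𝟙 (isY (part v)) Q.* 1ℚ)
        Q.+ share Q.* (𝟙 (isB (part v)) Q.* fromℕ (m + a))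
        ≡⟨ cong (q Q.* 𝟙 (stays (part v)) Q.+ (p - q) Q.* (𝟙 (isY (part v)) Q.* 1ℚ) Q.+_)
             (spread (isB (part v)) (λ Bv → subst (1 ≤_) size-isB (1≤size {T = isB ∘ part} v Bv))) ⟩
      q Q.* 𝟙 (stays (part v)) Q.+ (p - q) Q.* (𝟙 (isY (part v)) Q.* 1ℚ) Q.+ q Q.* 𝟙 (isB (part v))
        ≡⟨ balance-identity p q (𝟙 (stays (part v))) (𝟙 (isY (part v))) (𝟙 (isB (part v))) (𝟙 (linked Y (part v)))
             (balance-y (part v)) ⟩
      p Q.* 𝟙 (isY (part v)) Q.+ q Q.* 𝟙 (linked Y (part v))
        ≡⟨ μ-y v ⟨
      μ G p y v ∎
      where open ≡-Reasoning

    coupling : IsCoupling (μ G p x) (μ G p y) plan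
    coupling = plan-bounded ,
               (λ u → trans (Σℚ≡∑ (plan u)) (row-sum u)) ,
               (λ v → trans (Σℚ≡∑ (λ u → plan u v)) (column-sum v))

    plan-off-diagonal : ∀ {u v} → u ≢ v →
      plan u v ≡ q Q.* 0ℚ Q.+ (p - q) Q.* 𝟙 (xy-pair u v) Q.+ share Q.* 𝟙 (ab-pair u v)
    plan-off-diagonal {u} {v} u≢v =
      cong (λ e → q Q.* 𝟙 (e ∧ stays (part u)) Q.+ (p - q) Q.* 𝟙 (xy-pair u v) Q.+ share Q.* 𝟙 (ab-pair u v))
           (⌊≟⌋-≢ u≢v)

    tight-off-diagonal : ∀ {u v} → u ≢ v → ∀ b e → xy-pair u v ≡ b → ab-pair u v ≡ e →
      plan u v ≡ 0ℚ ⊎ dist G u v + φ (part v) ≤ φ (part u)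
    tight-off-diagonal {u} {v} u≢v true  _    xy _  = inj₂ (tight-along-edge u v u≢v (x→y-tight (part u) (part v) xy))
    tight-off-diagonal {u} {v} u≢v false true _  ab =
      inj₂ (Sum.[ tight-along-edge u v u≢v , tight-through-hub 1≤m+a u v ]′ (a→b-tight (part u) (part v) ab))
      where
      1≤m+a : 1 ≤ m + a
      1≤m+a = subst (1 ≤_) size-isB (1≤size {T = isB ∘ part} v (BoolP.∧-conicalʳ (isA (part u)) (isB (part v)) ab))
    tight-off-diagonal {u} {v} u≢v false false xy ab = inj₁ (trans (plan-off-diagonal u≢v)
      (trans (cong₂ (λ b e → q Q.* 0ℚ Q.+ (p - q) Q.* 𝟙 b Q.+ share Q.* 𝟙 e) xy ab) (vanish q (p - q) share)))
      where
      vanish : ∀ α β γ → α Q.* 0ℚ Q.+ β Q.* 0ℚ Q.+ γ Q.* 0ℚ ≡ 0ℚ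
      vanish = solve-∀ ℚ-ring

    plan-tight : TightFor G (φ ∘ part) plan
    plan-tight u v with toSum (u ≟ v)
    ... | inj₁ refl = inj₂ (ℕP.≤-reflexive (cong (_+ φ (part u)) (dist-refl G u)))
    ... | inj₂ u≢v  = tight-off-diagonal u≢v (xy-pair u v) (ab-pair u v) refl refl

    W : ℚ
    W = expectation (φ ∘ part) (μ G p x) - expectation (φ ∘ part) (μ G p y)

    isW : IsW G (μ G p x) (μ G p y) W
    isW = isW-of-tight-potential {G = G} {f = φ ∘ part} φ-lipschitz plan-tight coupling

    expectation-at : ∀ e → deg G e ≡ degree → ∀ {s} → ∑ℕ (λ v → if adj G e v then φ (part v) else 0) ≡ s →
      expectation (φ ∘ part) (μ G p e) ≡ p Q.* fromℕ (φ (part e)) Q.+ q Q.* fromℕ s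
    expectation-at e deg-e potential = trans (expectation-μ G (φ ∘ part) p e)
      (cong₂ (λ d s → p Q.* fromℕ (φ (part e)) Q.+ (1ℚ - p) Q.* invℕ d Q.* fromℕ s) deg-e potential)

    κ-linear : κp G x y W ≡ (1ℚ - p) Q.* ((fromℕ (2 * degree + 2) - fromℕ order) Q.* invℕ degree)
    κ-linear = begin
      κp G x y W
        ≡⟨ cong (λ d → 1ℚ - W Q.* invℕ d) dist-xy ⟩
      1ℚ - W Q.* 1ℚ
        ≡⟨ cong (λ w → 1ℚ - w Q.* 1ℚ) (cong₂ _-_ (expectation-at x deg-x potential-near-x)
                                                  (expectation-at y deg-y potential-near-y)) ⟩
      1ℚ - ((p Q.* 1ℚ Q.+ q Q.* fromℕ (c + (m + m + a))) - (p Q.* 0ℚ Q.+ q Q.* fromℕ (1 + c))) Q.* 1ℚ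
        ≡⟨ curvature-identity p (invℕ degree) (fromℕ (2 * degree + 2)) (fromℕ order) (fromℕ degree)
             (fromℕ (c + (m + m + a))) (fromℕ (1 + c)) totals (fromℕ*invℕ {degree} (s≤s z≤n)) ⟩
      (1ℚ - p) Q.* ((fromℕ (2 * degree + 2) - fromℕ order) Q.* invℕ degree) ∎
      where
      open ≡-Reasoning
      count : 2 * suc (c + (m + a)) + 2 + (c + (m + m + a)) ≡
              2 + (c + (m + (a + ((m + a) + m)))) + suc (c + (m + a)) + (1 + c)
      count = solve (c ∷ m ∷ a ∷ [])
      totals : fromℕ (2 * degree + 2) Q.+ fromℕ (c + (m + m + a)) ≡ fromℕ order Q.+ fromℕ degree Q.+ fromℕ (1 + c)
      totals = trans (≡.sym (fromℕ-+ (2 * degree + 2) (c + (m + m + a))))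
        (trans (cong fromℕ count)
        (trans (fromℕ-+ (order + degree) (1 + c)) (cong (Q._+ fromℕ (1 + c)) (fromℕ-+ order degree))))

  curvature : IsKappaLLY G x y ((fromℕ (2 * degree + 2) - fromℕ order) Q.* invℕ degree)
  curvature = isKappaLLY-of-linear G x y ((fromℕ (2 * degree + 2) - fromℕ order) Q.* invℕ degree) λ p ½<p p<1 →
    Curvature.W p ½<p p<1 , Curvature.isW p ½<p p<1 , Curvature.κ-linear p ½<p p<1

blowup-complete : ∀ c → Complete (BlowUp.G c 0 0)
blowup-complete c u v u≢v = linked⇒adj u v (core-linked u v u≢v) u≢v
  where
  open BlowUp c 0 0
  part-C : ∀ w → part (suc (suc w)) ≡ C
  part-C = VecAllP.lookup⁺ (VecAllP.++⁺ (VecAll-replicate {P = _≡ C} c refl) VecAll.[])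
  core-linked : ∀ u v → u ≢ v → linked (part u) (part v) ≡ true
  core-linked zero          zero           u≢v = ⊥-elim (u≢v refl)
  core-linked zero          (suc zero)     _   = refl
  core-linked zero          (suc (suc w))  _   rewrite part-C w = refl
  core-linked (suc zero)    zero           _   = refl
  core-linked (suc zero)    (suc zero)     u≢v = ⊥-elim (u≢v refl)
  core-linked (suc zero)    (suc (suc w))  _   rewrite part-C w = refl
  core-linked (suc (suc w)) zero           _   rewrite part-C w = refl
  core-linked (suc (suc w)) (suc zero)     _   rewrite part-C w = refl
  core-linked (suc (suc w)) (suc (suc w′)) _   rewrite part-C w | part-C w′ = refl

blowup-connectivity : ∀ c m a → IsConnectivity (BlowUp.G c m a) (BlowUp.degree c m a)
blowup-connectivity c zero    zero    = isConnectivity-complete {G = BlowUp.G c 0 0} (blowup-complete c)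
blowup-connectivity c (suc m) a       = BlowUp.Connectivity.isConnectivity c (suc m) a (s≤s z≤n)
blowup-connectivity c zero    (suc a) = BlowUp.Connectivity.isConnectivity c zero (suc a) (s≤s z≤n)

-- With n = k + 1 + d: for d < k take m = 0, otherwise c = 0.
blowup-parameters : ∀ n k → k + 1 ≤ n → n + 1 ≤ 3 * k →
  Σ ℕ λ c → Σ ℕ λ m → Σ ℕ λ a → BlowUp.order c m a ≡ n × BlowUp.degree c m a ≡ k
blowup-parameters n k k+1≤n n+1≤3k with ℕP.m≤n⇒∃[o]m+o≡n k+1≤n
... | d , refl with d ℕ.<? k
...   | yes d<k with ℕP.m≤n⇒∃[o]m+o≡n d<k
...     | e , refl = e , 0 , d , order≡ d e , degree≡ d e
  where
  order≡ : ∀ d e → 2 + (e + (0 + (d + ((0 + d) + 0)))) ≡ suc d + e + 1 + d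
  order≡ d e = solve (d ∷ e ∷ [])
  degree≡ : ∀ d e → suc (e + (0 + d)) ≡ suc d + e
  degree≡ d e = solve (d ∷ e ∷ [])
blowup-parameters n k k+1≤n n+1≤3k | d , refl | no d≮k with ℕP.m≤n⇒∃[o]m+o≡n (ℕP.≮⇒≥ d≮k)
... | f , refl
  with ℕP.m≤n⇒∃[o]m+o≡n (ℕP.+-cancelˡ-≤ (k + k) (f + 2) k (subst₂ _≤_ (regroup k f) (triple k) n+1≤3k))
  where
  regroup : ∀ k f → k + 1 + (k + f) + 1 ≡ k + k + (f + 2)
  regroup k f = solve (k ∷ f ∷ [])
  triple : ∀ k → 3 * k ≡ k + k + k
  triple k = solve (k ∷ [])
...   | e , refl = 0 , suc f , e , order≡ f e , degree≡ f e
  where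
  order≡ : ∀ f e → 2 + (0 + (suc f + (e + ((suc f + e) + suc f)))) ≡ f + 2 + e + 1 + (f + 2 + e + f)
  order≡ f e = solve (f ∷ e ∷ [])
  degree≡ : ∀ f e → suc (0 + (suc f + e)) ≡ f + 2 + e
  degree≡ f e = solve (f ∷ e ∷ [])

Realisation : ℕ → ℕ → Set
Realisation n k =
  Σ (Graph n) λ G → IsConnectivity G k ×
    Σ (Fin n) λ x → Σ (Fin n) λ y →
      (adj G x y ≡ true) × (deg G x ≡ k) × (deg G y ≡ k) ×
      IsKappaLLY G x y ((fromℕ (2 * k + 2) - fromℕ n) *ℚ invℕ k)

blowup-realisation : ∀ c m a → Realisation (BlowUp.order c m a) (BlowUp.degree c m a)
blowup-realisation c m a = G , blowup-connectivity c m a , x , y , refl , deg-x , deg-y , curvature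
  where open BlowUp c m a

theorem1p8 : (n k : ℕ) → 1 ≤ n → 1 ≤ k → (n ∸ k) % 2 ≡ 1 →
    n + 1 ≤ 3 * k → k + 1 ≤ n →
    Σ (Graph n) λ G → IsConnectivity G k ×
      Σ (Fin n) λ x → Σ (Fin n) λ y →
        (adj G x y ≡ true) × (deg G x ≡ k) × (deg G y ≡ k) ×
        IsKappaLLY G x y ((fromℕ (2 * k + 2) - fromℕ n) *ℚ invℕ k)
theorem1p8 n k _ _ _ n+1≤3k k+1≤n with blowup-parameters n k k+1≤n n+1≤3k
... | c , m , a , refl , refl = blowup-realisation c m a
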